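{- Let $G \cong C_{n_1} \oplus C_{n_2} \oplus \cdots \oplus C_{n_r}$ be a finite abelian group with $n_1 \mid n_2 \mid \cdots \mid n_r$. Consider the statements: (i) Every sequence $S$ over $G$ such that $0$ is not a term of $S$ and $N_0(S) = 2^{|S|-D(G)+1}$ contains exactly $|S|-D(G)+1$ minimal zero-sum subsequences, all of which are pairwise disjoint. (ii) There is a natural number $t = t(G)$ such that $|S| \le t$ for every sequence $S$ over $G$ such that $0$ is not a term of $S$ and $N_0(S) = 2^{|S|-D(G)+1}$. (iii) For every subgroup $H$ of $G$ isomorphic to $C_2$, $D(G) \ge D(G/H) + 2$. (iv) For every sequence $S$ over $G$ with $|S|\ge D(G)-1$, $E(S)$ contains no non-trivial subgroup of $G$. Then (i) implies (ii), and (ii), (iii), (iv) are equivalent.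
   Context: $C_n$ denotes the cyclic group of order $n$. A sequence over $G$ is a finite unordered list $S = g_1 \cdots g_m$ of elements of $G$ with repetition allowed; $|S| = m$; subsequences are sub-multisets. For $g \in G$, $N_g(S) = |\{I \subseteq [1,m] : \sum_{i\in I} g_i = g\}|$ (empty index set included). $D(G)$ is the smallest positive integer $\ell$ such that every sequence over $G$ of length at least $\ell$ has a nonempty subsequence with sum $0$. For $|S|\ge D(G)-1$, $E(S) = \{g\in G : N_g(S) = 2^{|S|-D(G)+1}\}$. A minimal zero-sum sequence is a nonempty sequence with sum $0$ none of whose nonempty proper subsequences has sum $0$. Two subsequences are disjoint if their greatest common divisor (longest sequence dividing both) is empty. -}

module Defs where

open import Level using ()
open import Data.Nat using (ℕ; zero; suc; _+_; _∸_; _^_; _≤_; _<_)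
open import Data.Nat.DivMod using (_mod_)
open import Data.Fin using (Fin; toℕ)
import Data.Fin as F
open import Data.Unit using (⊤; tt)
open import Data.Product using (_×_; _,_; Σ; ∃; proj₁; proj₂)
open import Data.Sum using (_⊎_)
open import Data.List using (List; []; _∷_; _++_; map; length; filter; foldr)
open import Data.List.Relation.Unary.All using (All; []; _∷_)
open import Data.List.Relation.Unary.Any using (Any)
open import Data.List.Relation.Unary.AllPairs using (AllPairs)
open import Data.List.Membership.Propositional using (_∈_; _∉_)
open import Data.List.Relation.Binary.Sublist.Propositional using (_⊆_)
open import Data.List.Relation.Binary.Permutation.Propositional using (_↭_)
open import Relation.Binary.PropositionalEquality using (_≡_; _≢_; refl)
open import Relation.Binary.Definitions using (DecidableEquality)
open import Relation.Nullary using (¬_; Dec; yes; no)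
open import Data.Empty using (⊥)

addF : {n : ℕ} → Fin n → Fin n → Fin n
addF {suc k} a b = (toℕ a + toℕ b) mod (suc k)

negF : {n : ℕ} → Fin n → Fin n
negF {suc k} a = (suc k ∸ toℕ a) mod (suc k)

zeroF : {n : ℕ} → 0 < n → Fin n
zeroF {suc k} _ = F.zero

-- G = C_{n_1} ⊕ ... ⊕ C_{n_r}, with ns = n_1 ∷ ... ∷ n_r ∷ [].
Elem : List ℕ → Set
Elem [] = ⊤
Elem (n ∷ ns) = Fin n × Elem ns

_≟E_ : {ns : List ℕ} → DecidableEquality (Elem ns)
_≟E_ {[]} tt tt = yes refl
_≟E_ {n ∷ ns} (a , x) (b , y) with a F.≟ b | x ≟E y
... | yes refl | yes refl = yes refl
... | no a≢b   | _        = no λ { refl → a≢b refl }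
... | yes _    | no x≢y   = no λ { refl → x≢y refl }

addE : {ns : List ℕ} → Elem ns → Elem ns → Elem ns
addE {[]} tt tt = tt
addE {n ∷ ns} (a , x) (b , y) = addF a b , addE x y

negE : {ns : List ℕ} → Elem ns → Elem ns
negE {[]} tt = tt
negE {n ∷ ns} (a , x) = negF a , negE x

zeroE : {ns : List ℕ} → All (0 <_) ns → Elem ns
zeroE [] = tt
zeroE (p ∷ ps) = zeroF p , zeroE ps

-- All 2^m index-subsets of a sequence, listed as subsequences (with multiplicity).
subs : {A : Set} → List A → List (List A)
subs [] = [] ∷ []
subs (x ∷ xs) = subs xs ++ map (x ∷_) (subs xs)

_≼_ : {A : Set} → List A → List A → Set
T ≼ S = ∃ λ U → (U ⊆ S) × (T ↭ U)

-- Disjoint: no common term (gcd is the empty sequence).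
Disjoint : {A : Set} → List A → List A → Set
Disjoint T U = ∀ x → x ∈ T → x ∈ U → ⊥

module Group (ns : List ℕ) (pos : All (0 <_) ns) where

  G : Set
  G = Elem ns

  0G : G
  0G = zeroE pos

  σ : List G → G
  σ = foldr addE 0G

  N : G → List G → ℕ
  N g S = length (filter (λ T → σ T ≟E g) (subs S))

  record IsSubgroup (H : G → Set) : Set where
    field
      has-0 : H 0G
      +-closed : ∀ x y → H x → H y → H (addE x y)
      neg-closed : ∀ x → H x → H (negE x)

  IsoC2 : (G → Set) → Set
  IsoC2 H = ∃ λ h → (h ≢ 0G) × (∀ x → (H x → (x ≡ 0G ⊎ x ≡ h)) × ((x ≡ 0G ⊎ x ≡ h) → H x))

  -- Davenport constant of G/H, where a sequence over G/H is represented
  -- by a sequence of representatives in G and "sum is 0 in G/H" means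
  -- "sum lies in H" (quotient as a setoid).
  HasNZS : (G → Set) → List G → Set
  HasNZS H S = ∃ λ T → (T ⊆ S) × (T ≢ []) × H (σ T)

  DavProp : (G → Set) → ℕ → Set
  DavProp H ℓ = ∀ (S : List G) → ℓ ≤ length S → HasNZS H S

  IsDavenportMod : (G → Set) → ℕ → Set
  IsDavenportMod H d = (1 ≤ d) × DavProp H d × (∀ ℓ → 1 ≤ ℓ → ℓ < d → ¬ DavProp H ℓ)

  IsZero : G → Set
  IsZero x = x ≡ 0G

  IsDavenport : ℕ → Set
  IsDavenport d = IsDavenportMod IsZero d

  IsMinZeroSum : List G → Set
  IsMinZeroSum T = (T ≢ []) × (σ T ≡ 0G)
    × (∀ U → U ≼ T → U ≢ [] → length U < length T → σ U ≢ 0G)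

  -- Hypothesis of (i),(ii): 0 not a term, and N_0(S) = 2^{|S|-D(G)+1}
  -- (the exponent is required to be a natural number, i.e. |S| ≥ D(G)-1).
  Extremal : ℕ → List G → Set
  Extremal d S = (0G ∉ S) × (d ≤ length S + 1) × (N 0G S ≡ 2 ^ (length S + 1 ∸ d))

  StmtI : ℕ → Set
  StmtI d = ∀ (S : List G) → Extremal d S →
    ∃ λ (Ts : List (List G)) →
        (length Ts ≡ length S + 1 ∸ d)
      × All (λ T → (T ≼ S) × IsMinZeroSum T) Ts
      × AllPairs Disjoint Ts
      × (∀ T → T ≼ S → IsMinZeroSum T → Any (T ↭_) Ts)

  StmtII : ℕ → Set
  StmtII d = ∃ λ (t : ℕ) → ∀ (S : List G) → Extremal d S → length S ≤ t

  StmtIII : ℕ → Set₁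
  StmtIII d = ∀ (H : G → Set) → IsSubgroup H → IsoC2 H →
    ∀ dH → IsDavenportMod H dH → dH + 2 ≤ d

  InE : ℕ → List G → G → Set
  InE d S g = N g S ≡ 2 ^ (length S + 1 ∸ d)

  StmtIV : ℕ → Set₁
  StmtIV d = ∀ (S : List G) → d ≤ length S + 1 →
    ∀ (H : G → Set) → IsSubgroup H → (∀ x → H x → InE d S x) → ∀ x → H x → x ≡ 0G

-- Everything rests on Olson's bound: if every sequence of length ℓ has a nonempty subsequence
-- with sum in the subgroup K, then at least 2^(|S|-ℓ+1) subsequences of S have sum in K.
--
-- (i) ⇒ (ii): the |S|-D(G)+1 disjoint minimal zero-sum subsequences all have length at least 2,
-- so |S| ≤ 2 D(G).
-- (ii), (iv) ⇒ (iii): if D(G/H) ≥ D(G) - 1 for H = {0, h}, there is a sequence T of length D(G) - 2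
-- without a nonempty subsequence summing into H; then N_0 = N_h = 2^j on h^(j+1) T, which gives
-- arbitrarily long extremal sequences and a sequence h T with H ⊆ E(h T).
-- (iii) ⇒ (iv): if 0 ≠ x ∈ E(S) has order k, counting subsequences with sum in K = ⟨x⟩ gives
-- 2^(|S|-D(G/K)+1) ≤ k 2^(|S|-D(G)+1), whereas D(G) ≥ D(G/K) + k - 1, and D(G) ≥ D(G/K) + 2 by (iii)
-- when k = 2; since k < 2^(k-1) for k ≥ 3 and 2 < 2^2, this is impossible.
-- (iv) ⇒ (ii): a long extremal sequence contains 2|G| copies of some g. Removing them one at a time,
-- the identity N_c(g T) = N_c(T) + N_(c-g)(T) together with Olson's bound for both terms forces
-- -b·g ∈ E for more and more b, until ⟨g⟩ ⊆ E; then (iv) gives g = 0.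

module Submission where

open import Defs
open import Level using (0ℓ)
open import Algebra.Bundles using (AbelianGroup; RawMonoid)
open import Data.Nat using (ℕ; zero; suc; _+_; _*_; _∸_; _^_; _≤_; _<_; _≤?_; s≤s; z≤n; NonZero; >-nonZero; >-nonZero⁻¹)
open import Data.Nat.Properties
open import Data.Nat.DivMod
open import Data.Nat.Divisibility using (_∣_; divides)
open import Data.Nat.ListAction using (product)
open import Data.Nat.ListAction.Properties using (∈⇒∣product; product≢0)
open import Data.Fin using (Fin; toℕ)
import Data.Fin as Fin
open import Data.Fin.Properties using (any?; toℕ-injective; toℕ-fromℕ<; toℕ<n; toℕ-inject; ¬∀⟶∃¬-smallest)
open import Data.Unit using (tt)
open import Data.Product using (_×_; _,_; proj₁; proj₂; ∃)
open import Data.List.Relation.Unary.All as All using (All; []; _∷_)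
open import Data.List.Relation.Unary.All.Properties using (All¬⇒¬Any; ++⁺; replicate⁺)
open import Data.List.Relation.Unary.Linked using (Linked)
open import Data.List.Base using (List; []; _∷_; _++_; map; length; filter; replicate; take; concat; tabulate; allFin; cartesianProduct)
open import Data.List.Properties using (++-assoc; length-++; length-++-≤ˡ; length-map; length-take; length-replicate; length-tabulate; filter-++; filter-≐; filter-some; filter-none; filter-accept; filter-reject; ≡-dec)
open import Data.List.Membership.Propositional using (_∈_; _∉_; lose; find)
open import Data.List.Membership.Propositional.Properties using (∈-++⁺ˡ; ∈-++⁺ʳ; ∈-++⁻; ∈-map⁺; ∈-map⁻; ∈-concat⁻′; ∈-tabulate⁺; ∈-tabulate⁻; ∈-allFin; ∈-cartesianProduct⁺)
open import Data.List.Relation.Unary.AllPairs using (AllPairs; []; _∷_)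
open import Data.List.Relation.Unary.Any using (here; there) renaming (any? to anyᴸ?)
open import Data.List.Relation.Binary.Sublist.Propositional using (_⊆_; []; _∷_; _∷ʳ_; minimum; from∈; ⊆-refl; ⊆-trans)
open import Data.List.Relation.Binary.Sublist.Propositional.Properties using (++⁺ʳ; take-⊆; length-mono-≤; Any-resp-⊆)
open import Data.List.Relation.Binary.Permutation.Propositional using (_↭_; ↭-sym; prep; swap) renaming (refl to ↭-refl; trans to ↭-trans)
open import Data.List.Relation.Binary.Permutation.Propositional.Properties using (shift; shifts; ↭-length; ∈-resp-↭; ++⁺ˡ) renaming (++⁺ to ++⁺-↭)
open import Data.Empty using (⊥; ⊥-elim)
open import Data.Sum using (_⊎_; inj₁; inj₂)
open import Data.Bool using (true; false)
open import Function using (_∘_; case_of_)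
open import Relation.Nullary using (¬_; yes; no; does; ¬?)
open import Relation.Nullary.Decidable using (map′; _×-dec_; _⊎-dec_; decidable-stable)
open import Relation.Nullary.Negation using (¬¬-map)
open import Relation.Nullary.Decidable.Core using (¬¬-excluded-middle)
open import Relation.Unary using (Pred; Decidable)
open import Relation.Binary.Definitions using (DecidableEquality)
open import Data.Nat.Tactic.RingSolver using (solve-∀)
open import Algebra.Properties.CommutativeSemigroup +-commutativeSemigroup using (interchange)
open import Relation.Binary.PropositionalEquality

toℕ-addF : ∀ {n} (a b : Fin (suc n)) → toℕ (addF a b) ≡ (toℕ a + toℕ b) % suc n
toℕ-addF {n} a b = toℕ-fromℕ< (m%n<n (toℕ a + toℕ b) (suc n))

toℕ-negF : ∀ {n} (a : Fin (suc n)) → toℕ (negF a) ≡ (suc n ∸ toℕ a) % suc n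
toℕ-negF {n} a = toℕ-fromℕ< (m%n<n (suc n ∸ toℕ a) (suc n))

[m%n+o]%n≡[m+o]%n : ∀ m o n .{{_ : NonZero n}} → (m % n + o) % n ≡ (m + o) % n
[m%n+o]%n≡[m+o]%n m o n = begin
  (m % n + o) % n          ≡⟨ %-distribˡ-+ (m % n) o n ⟩
  (m % n % n + o % n) % n  ≡⟨ cong (λ z → (z + o % n) % n) (m%n%n≡m%n m n) ⟩
  (m % n + o % n) % n      ≡⟨ %-distribˡ-+ m o n ⟨
  (m + o) % n              ∎
  where open ≡-Reasoning

[m+o%n]%n≡[m+o]%n : ∀ m o n .{{_ : NonZero n}} → (m + o % n) % n ≡ (m + o) % n
[m+o%n]%n≡[m+o]%n m o n = begin
  (m + o % n) % n  ≡⟨ cong (_% n) (+-comm m (o % n)) ⟩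
  (o % n + m) % n  ≡⟨ [m%n+o]%n≡[m+o]%n o m n ⟩
  (o + m) % n      ≡⟨ cong (_% n) (+-comm o m) ⟩
  (m + o) % n      ∎
  where open ≡-Reasoning

addF-comm : ∀ {n} (a b : Fin n) → addF a b ≡ addF b a
addF-comm {suc n} a b = toℕ-injective (begin
  toℕ (addF a b)             ≡⟨ toℕ-addF a b ⟩
  (toℕ a + toℕ b) % suc n    ≡⟨ cong (_% suc n) (+-comm (toℕ a) (toℕ b)) ⟩
  (toℕ b + toℕ a) % suc n    ≡⟨ toℕ-addF b a ⟨
  toℕ (addF b a)             ∎)
  where open ≡-Reasoning

addF-assoc : ∀ {n} (a b c : Fin n) → addF (addF a b) c ≡ addF a (addF b c)
addF-assoc {suc n} a b c = toℕ-injective (begin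
  toℕ (addF (addF a b) c)                     ≡⟨ toℕ-addF (addF a b) c ⟩
  (toℕ (addF a b) + toℕ c) % suc n            ≡⟨ cong (λ z → (z + toℕ c) % suc n) (toℕ-addF a b) ⟩
  ((toℕ a + toℕ b) % suc n + toℕ c) % suc n   ≡⟨ [m%n+o]%n≡[m+o]%n (toℕ a + toℕ b) (toℕ c) (suc n) ⟩
  (toℕ a + toℕ b + toℕ c) % suc n             ≡⟨ cong (_% suc n) (+-assoc (toℕ a) (toℕ b) (toℕ c)) ⟩
  (toℕ a + (toℕ b + toℕ c)) % suc n           ≡⟨ [m+o%n]%n≡[m+o]%n (toℕ a) (toℕ b + toℕ c) (suc n) ⟨
  (toℕ a + (toℕ b + toℕ c) % suc n) % suc n   ≡⟨ cong (λ z → (toℕ a + z) % suc n) (toℕ-addF b c) ⟨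
  (toℕ a + toℕ (addF b c)) % suc n            ≡⟨ toℕ-addF a (addF b c) ⟨
  toℕ (addF a (addF b c))                     ∎)
  where open ≡-Reasoning

addF-identityˡ : ∀ {n} (p : 0 < n) (a : Fin n) → addF (zeroF p) a ≡ a
addF-identityˡ {suc n} p a = toℕ-injective (trans (toℕ-addF Fin.zero a) (m<n⇒m%n≡m (toℕ<n a)))

addF-inverseʳ : ∀ {n} (p : 0 < n) (a : Fin n) → addF a (negF a) ≡ zeroF p
addF-inverseʳ {suc n} p a = toℕ-injective (begin
  toℕ (addF a (negF a))                      ≡⟨ toℕ-addF a (negF a) ⟩
  (toℕ a + toℕ (negF a)) % suc n             ≡⟨ cong (λ z → (toℕ a + z) % suc n) (toℕ-negF a) ⟩
  (toℕ a + (suc n ∸ toℕ a) % suc n) % suc n  ≡⟨ [m+o%n]%n≡[m+o]%n (toℕ a) (suc n ∸ toℕ a) (suc n) ⟩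
  (toℕ a + (suc n ∸ toℕ a)) % suc n          ≡⟨ cong (_% suc n) (m+[n∸m]≡n (<⇒≤ (toℕ<n a))) ⟩
  suc n % suc n                              ≡⟨ n%n≡0 (suc n) ⟩
  0                                          ∎)
  where open ≡-Reasoning

addE-comm : ∀ {ns} (x y : Elem ns) → addE x y ≡ addE y x
addE-comm {[]}     tt      tt      = refl
addE-comm {n ∷ ns} (a , x) (b , y) = cong₂ _,_ (addF-comm a b) (addE-comm x y)

addE-assoc : ∀ {ns} (x y z : Elem ns) → addE (addE x y) z ≡ addE x (addE y z)
addE-assoc {[]}     tt      tt      tt      = refl
addE-assoc {n ∷ ns} (a , x) (b , y) (c , z) = cong₂ _,_ (addF-assoc a b c) (addE-assoc x y z)

addE-identityˡ : ∀ {ns} (pos : All (0 <_) ns) (x : Elem ns) → addE (zeroE pos) x ≡ x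
addE-identityˡ []        tt      = refl
addE-identityˡ (p ∷ pos) (a , x) = cong₂ _,_ (addF-identityˡ p a) (addE-identityˡ pos x)

addE-inverseʳ : ∀ {ns} (pos : All (0 <_) ns) (x : Elem ns) → addE x (negE x) ≡ zeroE pos
addE-inverseʳ []        tt      = refl
addE-inverseʳ (p ∷ pos) (a , x) = cong₂ _,_ (addF-inverseʳ p a) (addE-inverseʳ pos x)

allElements : ∀ ns → List (Elem ns)
allElements []       = tt ∷ []
allElements (n ∷ ns) = cartesianProduct (allFin n) (allElements ns)

∈-allElements : ∀ {ns} (x : Elem ns) → x ∈ allElements ns
∈-allElements {[]}     tt      = here refl
∈-allElements {n ∷ ns} (a , x) = ∈-cartesianProduct⁺ (∈-allFin a) (∈-allElements x)

elem-rawMonoid : ∀ {ns} → All (0 <_) ns → RawMonoid 0ℓ 0ℓ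
elem-rawMonoid {ns} pos = record { Carrier = Elem ns ; _≈_ = _≡_ ; _∙_ = addE ; ε = zeroE pos }

module _ where
  open import Algebra.Definitions.RawMonoid using () renaming (_×_ to _·_)

  ·-common-multiple≡ε : ∀ {ns} (pos : All (0 <_) ns) k → All (_∣ k) ns →
                        ∀ g → _·_ (elem-rawMonoid pos) k g ≡ zeroE pos
  ·-common-multiple≡ε [] k [] tt = refl
  ·-common-multiple≡ε {suc n ∷ ns} (p ∷ pos) k (n∣k ∷ ns∣k) (a , y) =
    cong₂ _,_ (toℕ-injective (trans (toℕ-proj₁ k) (k*a%[1+n]≡0 n∣k))) (trans (proj₂-× k) (·-common-multiple≡ε pos k ns∣k y))
    where
    _×ᴱ_ : ℕ → Elem (suc n ∷ ns) → Elem (suc n ∷ ns)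
    _×ᴱ_ = _·_ (elem-rawMonoid (p ∷ pos))
    toℕ-proj₁ : ∀ j → toℕ (proj₁ (j ×ᴱ (a , y))) ≡ (j * toℕ a) % suc n
    toℕ-proj₁ zero    = refl
    toℕ-proj₁ (suc j) = begin
      toℕ (addF a (proj₁ (j ×ᴱ (a , y))))              ≡⟨ toℕ-addF a _ ⟩
      (toℕ a + toℕ (proj₁ (j ×ᴱ (a , y)))) % suc n     ≡⟨ cong (λ z → (toℕ a + z) % suc n) (toℕ-proj₁ j) ⟩
      (toℕ a + (j * toℕ a) % suc n) % suc n            ≡⟨ [m+o%n]%n≡[m+o]%n (toℕ a) (j * toℕ a) (suc n) ⟩
      (toℕ a + j * toℕ a) % suc n                      ∎
      where open ≡-Reasoning
    proj₂-× : ∀ j → proj₂ (j ×ᴱ (a , y)) ≡ _·_ (elem-rawMonoid pos) j y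
    proj₂-× zero    = refl
    proj₂-× (suc j) = cong (addE y) (proj₂-× j)
    k*a%[1+n]≡0 : suc n ∣ k → (k * toℕ a) % suc n ≡ 0
    k*a%[1+n]≡0 (divides q refl) = begin
      (q * suc n * toℕ a) % suc n    ≡⟨ cong (_% suc n) (*-assoc q (suc n) (toℕ a)) ⟩
      (q * (suc n * toℕ a)) % suc n  ≡⟨ cong (λ z → (q * z) % suc n) (*-comm (suc n) (toℕ a)) ⟩
      (q * (toℕ a * suc n)) % suc n  ≡⟨ cong (_% suc n) (*-assoc q (toℕ a) (suc n)) ⟨
      (q * toℕ a * suc n) % suc n    ≡⟨ m*n%n≡0 (q * toℕ a) (suc n) ⟩
      0                              ∎
      where open ≡-Reasoning

[1+t]+a+1≡t+[a+2] : ∀ t a → suc t + a + 1 ≡ t + (a + 2)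
[1+t]+a+1≡t+[a+2] = solve-∀

2^[1+k]≡2^k+2^k : ∀ k → 2 ^ suc k ≡ 2 ^ k + 2 ^ k
2^[1+k]≡2^k+2^k k = cong (2 ^ k +_) (+-identityʳ (2 ^ k))

+-halves : ∀ {a b c} → a + b ≡ c + c → c ≤ a → c ≤ b → a ≡ c × b ≡ c
+-halves {a} {b} {c} a+b≡c+c c≤a c≤b = ≤-antisym a≤c c≤a , ≤-antisym b≤c c≤b
  where
  a≤c : a ≤ c
  a≤c = +-cancelʳ-≤ c a c (≤-trans (+-monoʳ-≤ a c≤b) (≤-reflexive a+b≡c+c))
  b≤c : b ≤ c
  b≤c = +-cancelˡ-≤ c b c (≤-trans (+-monoˡ-≤ b c≤a) (≤-reflexive a+b≡c+c))

¬¬-least : {Q : ℕ → Set} → (∀ {m n} → m ≤ n → Q m → Q n) →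
           ∀ n → Q n → ¬ ¬ (∃ λ ℓ → Q ℓ × (∀ ℓ′ → ℓ′ < ℓ → ¬ Q ℓ′))
¬¬-least up zero    q k = k (0 , q , λ _ ())
¬¬-least up (suc n) q k = ¬¬-excluded-middle λ
  { (yes qn) → ¬¬-least up n qn k
  ; (no ¬qn) → k (suc n , q , λ ℓ′ ℓ′<1+n qℓ′ → ¬qn (up (≤-pred ℓ′<1+n) qℓ′)) }

3+n<2^[2+n] : ∀ n → 3 + n < 2 ^ (2 + n)
3+n<2^[2+n] zero    = ≤-refl
3+n<2^[2+n] (suc n) = begin-strict
  4 + n                      <⟨ m<m+n (4 + n) (s≤s z≤n) ⟩
  (4 + n) + (4 + n)          ≤⟨ +-mono-≤ (3+n<2^[2+n] n) (3+n<2^[2+n] n) ⟩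
  2 ^ (2 + n) + 2 ^ (2 + n)  ≡⟨ 2^[1+k]≡2^k+2^k (2 + n) ⟨
  2 ^ (3 + n)                ∎
  where open ≤-Reasoning

2^-squeeze : ∀ {s d ℓ J k} → ℓ + J ≤ d → d ≤ s → k < 2 ^ J → ¬ (2 ^ (s ∸ ℓ) ≤ k * 2 ^ (s ∸ d))
2^-squeeze {s} {d} {ℓ} {J} {k} ℓ+J≤d d≤s k<2^J 2^[s∸ℓ]≤ = <-irrefl refl (begin-strict
  2 ^ (s ∸ d) * 2 ^ J  ≡⟨ ^-distribˡ-+-* 2 (s ∸ d) J ⟨
  2 ^ (s ∸ d + J)      ≤⟨ ^-monoʳ-≤ 2 s∸d+J≤s∸ℓ ⟩
  2 ^ (s ∸ ℓ)          ≤⟨ 2^[s∸ℓ]≤ ⟩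
  k * 2 ^ (s ∸ d)      <⟨ *-monoˡ-< (2 ^ (s ∸ d)) {{m^n≢0 2 (s ∸ d)}} k<2^J ⟩
  2 ^ J * 2 ^ (s ∸ d)  ≡⟨ *-comm (2 ^ J) (2 ^ (s ∸ d)) ⟩
  2 ^ (s ∸ d) * 2 ^ J  ∎)
  where
  open ≤-Reasoning
  s∸d+J≤s∸ℓ : s ∸ d + J ≤ s ∸ ℓ
  s∸d+J≤s∸ℓ = m+n≤o⇒m≤o∸n (s ∸ d + J) (begin
    s ∸ d + J + ℓ    ≡⟨ +-assoc (s ∸ d) J ℓ ⟩
    s ∸ d + (J + ℓ)  ≤⟨ +-monoʳ-≤ (s ∸ d) (subst (_≤ d) (+-comm ℓ J) ℓ+J≤d) ⟩
    s ∸ d + d        ≡⟨ m∸n+n≡m d≤s ⟩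
    s                ∎)

choose-J : ∀ {ℓ d} k′ → 1 ≤ k′ → ℓ + k′ ≤ d → (k′ ≡ 1 → ℓ + 2 ≤ d) → ∃ λ J → suc k′ < 2 ^ J × ℓ + J ≤ d
choose-J (suc zero)    _ _      order-two = 2 , s≤s (s≤s (s≤s z≤n)) , order-two refl
choose-J (suc (suc n)) _ ℓ+k′≤d _         = 2 + n , 3+n<2^[2+n] n , ℓ+k′≤d

module _ {A : Set} where

  ∈-subs⁺ : {T S : List A} → T ⊆ S → T ∈ subs S
  ∈-subs⁺ []                   = here refl
  ∈-subs⁺ (y ∷ʳ T⊆S)           = ∈-++⁺ˡ (∈-subs⁺ T⊆S)
  ∈-subs⁺ {S = x ∷ S} (refl ∷ T⊆S) = ∈-++⁺ʳ (subs S) (∈-map⁺ (x ∷_) (∈-subs⁺ T⊆S))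

  ∈-subs⁻ : {T : List A} (S : List A) → T ∈ subs S → T ⊆ S
  ∈-subs⁻ []      (here refl) = []
  ∈-subs⁻ (x ∷ S) T∈ with ∈-++⁻ (subs S) T∈
  ... | inj₁ T∈subsS = x ∷ʳ ∈-subs⁻ S T∈subsS
  ... | inj₂ T∈map with ∈-map⁻ (x ∷_) T∈map
  ...   | _ , T′∈subsS , refl = refl ∷ ∈-subs⁻ S T′∈subsS

  length-filter-subs-∷ : {P : Pred (List A) 0ℓ} (P? : Decidable P) (x : A) (S : List A) →
    length (filter P? (subs (x ∷ S))) ≡ length (filter P? (subs S)) + length (filter (P? ∘ (x ∷_)) (subs S))
  length-filter-subs-∷ P? x S = begin
    length (filter P? (subs S ++ map (x ∷_) (subs S)))
      ≡⟨ cong length (filter-++ P? (subs S) _) ⟩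
    length (filter P? (subs S) ++ filter P? (map (x ∷_) (subs S)))
      ≡⟨ length-++ (filter P? (subs S)) ⟩
    length (filter P? (subs S)) + length (filter P? (map (x ∷_) (subs S)))
      ≡⟨ cong (length (filter P? (subs S)) +_) (length-filter-map (subs S)) ⟩
    length (filter P? (subs S)) + length (filter (P? ∘ (x ∷_)) (subs S)) ∎
    where
    open ≡-Reasoning
    length-filter-map : ∀ Ts → length (filter P? (map (x ∷_) Ts)) ≡ length (filter (P? ∘ (x ∷_)) Ts)
    length-filter-map []       = refl
    length-filter-map (T ∷ Ts) with does (P? (x ∷ T))
    ... | true  = cong suc (length-filter-map Ts)
    ... | false = length-filter-map Ts

  ⊆⇒↭++ : {U S : List A} → U ⊆ S → ∃ λ R → S ↭ U ++ R
  ⊆⇒↭++ []                        = [] , ↭-refl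
  ⊆⇒↭++ (y ∷ʳ U⊆S) with ⊆⇒↭++ U⊆S
  ... | R , S↭ = y ∷ R , ↭-trans (prep y S↭) (↭-sym (shift y _ R))
  ⊆⇒↭++ (refl ∷ U⊆S) with ⊆⇒↭++ U⊆S
  ... | R , S↭ = R , prep _ S↭

  ⊆-merge-disjoint : {U V S : List A} → U ⊆ S → V ⊆ S → Disjoint U V → ∃ λ W → W ⊆ S × U ++ V ↭ W
  ⊆-merge-disjoint [] [] _ = [] , [] , ↭-refl
  ⊆-merge-disjoint (x ∷ʳ U⊆S) (.x ∷ʳ V⊆S) UV-disjoint with ⊆-merge-disjoint U⊆S V⊆S UV-disjoint
  ... | W , W⊆S , ↭W = W , x ∷ʳ W⊆S , ↭W
  ⊆-merge-disjoint {x ∷ U} (refl ∷ U⊆S) (.x ∷ʳ V⊆S) UV-disjoint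
    with ⊆-merge-disjoint U⊆S V⊆S (λ y y∈U y∈V → UV-disjoint y (there y∈U) y∈V)
  ... | W , W⊆S , ↭W = x ∷ W , refl ∷ W⊆S , prep x ↭W
  ⊆-merge-disjoint {U} {x ∷ V} (.x ∷ʳ U⊆S) (refl ∷ V⊆S) UV-disjoint
    with ⊆-merge-disjoint U⊆S V⊆S (λ y y∈U y∈V → UV-disjoint y y∈U (there y∈V))
  ... | W , W⊆S , ↭W = x ∷ W , refl ∷ W⊆S , ↭-trans (shift x U V) (prep x ↭W)
  ⊆-merge-disjoint {x ∷ U} {.x ∷ V} (refl ∷ _) (refl ∷ _) UV-disjoint = ⊥-elim (UV-disjoint x (here refl) (here refl))

  ≼-++ : {T U S : List A} → T ≼ S → U ≼ S → Disjoint T U → (T ++ U) ≼ S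
  ≼-++ (T′ , T′⊆S , T↭T′) (U′ , U′⊆S , U↭U′) TU-disjoint
    with ⊆-merge-disjoint T′⊆S U′⊆S
           (λ y y∈T′ y∈U′ → TU-disjoint y (∈-resp-↭ (↭-sym T↭T′) y∈T′) (∈-resp-↭ (↭-sym U↭U′) y∈U′))
  ... | W , W⊆S , ↭W = W , W⊆S , ↭-trans (++⁺-↭ T↭T′ U↭U′) ↭W

  ≼-concat : {S : List A} (Ts : List (List A)) → All (_≼ S) Ts → AllPairs Disjoint Ts → concat Ts ≼ S
  ≼-concat []       []             []                   = [] , minimum _ , ↭-refl
  ≼-concat (T ∷ Ts) (T≼S ∷ Ts≼S) (T-disjoint ∷ Ts-disjoint) =
    ≼-++ T≼S (≼-concat Ts Ts≼S Ts-disjoint) λ y y∈T y∈⋃Ts →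
      let U , y∈U , U∈Ts = ∈-concat⁻′ Ts y∈⋃Ts in All.lookup T-disjoint U∈Ts y y∈T y∈U

  ≼⇒length≤ : {T S : List A} → T ≼ S → length T ≤ length S
  ≼⇒length≤ (U , U⊆S , T↭U) = ≤-trans (≤-reflexive (↭-length T↭U)) (length-mono-≤ U⊆S)

  ≼-∈ : {T S : List A} {x : A} → T ≼ S → x ∈ T → x ∈ S
  ≼-∈ (U , U⊆S , T↭U) x∈T = Any-resp-⊆ U⊆S (∈-resp-↭ T↭U x∈T)

  2*length≤length-concat : (Ts : List (List A)) → All (λ T → 2 ≤ length T) Ts → length Ts + length Ts ≤ length (concat Ts)
  2*length≤length-concat []       []             = z≤n
  2*length≤length-concat (T ∷ Ts) (2≤|T| ∷ 2≤|Ts|) = begin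
    suc (length Ts) + suc (length Ts)  ≡⟨ cong suc (+-suc (length Ts) (length Ts)) ⟩
    2 + (length Ts + length Ts)        ≤⟨ +-mono-≤ 2≤|T| (2*length≤length-concat Ts 2≤|Ts|) ⟩
    length T + length (concat Ts)      ≡⟨ length-++ T ⟨
    length (T ++ concat Ts)            ∎
    where open ≤-Reasoning

  length-filter-≤-split : {P Q : Pred A 0ℓ} (P? : Decidable P) (Q? : Decidable Q) (L : List A) →
    length (filter P? L) ≤ length (filter Q? L) + length (filter (λ a → P? a ×-dec ¬? (Q? a)) L)
  length-filter-≤-split P? Q? [] = z≤n
  length-filter-≤-split P? Q? (a ∷ L) with P? a | Q? a
  ... | yes _ | yes _ = s≤s (length-filter-≤-split P? Q? L)
  ... | yes _ | no  _ = ≤-trans (s≤s (length-filter-≤-split P? Q? L)) (≤-reflexive (sym (+-suc _ _)))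
  ... | no  _ | yes _ = ≤-trans (length-filter-≤-split P? Q? L) (n≤1+n _)
  ... | no  _ | no  _ = length-filter-≤-split P? Q? L

  ⊆-++⁻ : (X : List A) {Y V : List A} → V ⊆ X ++ Y → ∃ λ V₁ → ∃ λ V₂ → V ≡ V₁ ++ V₂ × V₁ ⊆ X × V₂ ⊆ Y
  ⊆-++⁻ []      V⊆Y = [] , _ , refl , [] , V⊆Y
  ⊆-++⁻ (x ∷ X) (.x ∷ʳ V⊆) with ⊆-++⁻ X V⊆
  ... | V₁ , V₂ , refl , V₁⊆X , V₂⊆Y = V₁ , V₂ , refl , x ∷ʳ V₁⊆X , V₂⊆Y
  ⊆-++⁻ (x ∷ X) (refl ∷ V⊆) with ⊆-++⁻ X V⊆
  ... | V₁ , V₂ , refl , V₁⊆X , V₂⊆Y = x ∷ V₁ , V₂ , refl , refl ∷ V₁⊆X , V₂⊆Y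

  ⊆-replicate⁻ : ∀ n {x : A} {V} → V ⊆ replicate n x → V ≡ replicate (length V) x
  ⊆-replicate⁻ zero    []           = refl
  ⊆-replicate⁻ (suc n) (_ ∷ʳ V⊆)    = ⊆-replicate⁻ n V⊆
  ⊆-replicate⁻ (suc n) (refl ∷ V⊆)  = cong (_ ∷_) (⊆-replicate⁻ n V⊆)

  replicate-+ : ∀ m n {x : A} → replicate (m + n) x ≡ replicate m x ++ replicate n x
  replicate-+ zero    n = refl
  replicate-+ (suc m) n = cong (_ ∷_) (replicate-+ m n)

  ∈-replicate⁺ : ∀ {n} {x : A} → 1 ≤ n → x ∈ replicate n x
  ∈-replicate⁺ (s≤s z≤n) = here refl

  replicate-⊆ : ∀ {m n} {x : A} → m ≤ n → replicate m x ⊆ replicate n x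
  replicate-⊆ {n = n}     z≤n       = minimum (replicate n _)
  replicate-⊆             (s≤s m≤n) = refl ∷ replicate-⊆ m≤n

  module _ (_≟_ : DecidableEquality A) where

    split-occurrences : ∀ y S → ∃ λ c → ∃ λ S′ → S ↭ replicate c y ++ S′ × All (_≢ y) S′
    split-occurrences y []      = 0 , [] , ↭-refl , []
    split-occurrences y (x ∷ S) with split-occurrences y S | x ≟ y
    ... | c , S′ , S↭ , S′≢y | yes refl = suc c , S′ , prep y S↭ , S′≢y
    ... | c , S′ , S↭ , S′≢y | no x≢y   = c , x ∷ S′ , ↭-trans (prep x S↭) (↭-sym (shift x (replicate c y) S′)) , x≢y ∷ S′≢y

    pigeonhole : ∀ (L : List A) R S → All (_∈ L) S →
                 (∃ λ g → ∃ λ S′ → S ↭ replicate R g ++ S′) ⊎ length S ≤ length L * R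
    pigeonhole []      R []      _         = inj₂ z≤n
    pigeonhole []      R (x ∷ S) (() ∷ _)
    pigeonhole (y ∷ L) R S       S⊆yL with split-occurrences y S
    ... | c , S′ , S↭ , S′≢y with R ≤? c
    ...   | yes R≤c = inj₁ (y , replicate (c ∸ R) y ++ S′ , subst (S ↭_) c-split S↭)
      where
      c-split : replicate c y ++ S′ ≡ replicate R y ++ (replicate (c ∸ R) y ++ S′)
      c-split = begin
        replicate c y ++ S′                             ≡⟨ cong (λ n → replicate n y ++ S′) (m+[n∸m]≡n R≤c) ⟨
        replicate (R + (c ∸ R)) y ++ S′                 ≡⟨ cong (_++ S′) (replicate-+ R (c ∸ R)) ⟩
        (replicate R y ++ replicate (c ∸ R) y) ++ S′    ≡⟨ ++-assoc (replicate R y) _ S′ ⟩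
        replicate R y ++ (replicate (c ∸ R) y ++ S′)    ∎
        where open ≡-Reasoning
    ...   | no R≰c with pigeonhole L R S′ S′⊆L
      where
      S′⊆L : All (_∈ L) S′
      S′⊆L = All.tabulate λ {x} x∈S′ → case All.lookup S⊆yL (∈-resp-↭ (↭-sym S↭) (∈-++⁺ʳ (replicate c y) x∈S′)) of λ
        { (here x≡y) → ⊥-elim (All.lookup S′≢y x∈S′ x≡y) ; (there x∈L) → x∈L }
    ...     | inj₁ (g , S″ , S′↭) = inj₁ (g , replicate c y ++ S″ ,
               ↭-trans S↭ (↭-trans (++⁺ˡ (replicate c y) S′↭) (shifts (replicate c y) (replicate R g))))
    ...     | inj₂ |S′|≤ = inj₂ (begin
               length S                        ≡⟨ ↭-length S↭ ⟩
               length (replicate c y ++ S′)     ≡⟨ length-++ (replicate c y) ⟩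
               length (replicate c y) + length S′ ≡⟨ cong (_+ length S′) (length-replicate c) ⟩
               c + length S′                    ≤⟨ +-mono-≤ (<⇒≤ (≰⇒> R≰c)) |S′|≤ ⟩
               R + length L * R                 ∎)
      where open ≤-Reasoning

module _ {A B : Set} (_≟_ : DecidableEquality B) (f : A → B) where

  length-filter-≤-classes : {P : Pred A 0ℓ} (P? : Decidable P) (cs : List B) {b : ℕ} (L : List A) →
    (∀ {a} → P a → f a ∈ cs) → (∀ {c} → c ∈ cs → length (filter (λ a → f a ≟ c) L) ≤ b) →
    length (filter P? L) ≤ length cs * b
  length-filter-≤-classes P? [] L classified _ =
    ≤-reflexive (cong length (filter-none P? {L} (All.tabulate λ _ Pa → case classified Pa of λ ())))
  length-filter-≤-classes {P} P? (c ∷ cs) {b} L classified bounded = begin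
    length (filter P? L)                                    ≤⟨ length-filter-≤-split P? (λ a → f a ≟ c) L ⟩
    length (filter (λ a → f a ≟ c) L) + length (filter P′? L) ≤⟨ +-mono-≤ (bounded (here refl))
                                                                  (length-filter-≤-classes P′? cs L classified′ (bounded ∘ there)) ⟩
    b + length cs * b                                        ∎
    where
    open ≤-Reasoning
    P′? : Decidable (λ a → P a × f a ≢ c)
    P′? a = P? a ×-dec ¬? (f a ≟ c)
    classified′ : ∀ {a} → P a × f a ≢ c → f a ∈ cs
    classified′ (Pa , fa≢c) with classified Pa
    ... | here fa≡c = ⊥-elim (fa≢c fa≡c)
    ... | there fa∈cs = fa∈cs

module _ (ns : List ℕ) (pos : All (0 <_) ns) where
  open Group ns pos

  +-abelianGroup : AbelianGroup 0ℓ 0ℓ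
  +-abelianGroup = record
    { Carrier = G ; _≈_ = _≡_ ; _∙_ = addE ; ε = 0G ; _⁻¹ = negE
    ; isAbelianGroup = record
      { isGroup = record
        { isMonoid = record
          { isSemigroup = record { isMagma = record { isEquivalence = isEquivalence ; ∙-cong = cong₂ addE } ; assoc = addE-assoc }
          ; identity = addE-identityˡ pos , λ x → trans (addE-comm x 0G) (addE-identityˡ pos x) }
        ; inverse = (λ x → trans (addE-comm (negE x) x) (addE-inverseʳ pos x)) , addE-inverseʳ pos
        ; ⁻¹-cong = cong negE }
      ; comm = addE-comm } }

  open AbelianGroup +-abelianGroup public using (_∙_; _⁻¹; _-_; assoc; comm; identityˡ; identityʳ; inverseˡ; inverseʳ; monoid; group)
  open import Algebra.Properties.Group group public using (identityʳ-unique; inverseʳ-unique; ⁻¹-involutive; ε⁻¹≈ε; x∙y⁻¹≈ε⇒x≈y; x≈y⇒x∙y⁻¹≈ε)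
  open import Algebra.Properties.AbelianGroup +-abelianGroup public using (⁻¹-∙-comm; ⁻¹-anti-homo‿-; xyx⁻¹≈y)
  open import Algebra.Properties.Monoid.Mult monoid public using (×-homo-+; ×-assocˡ) renaming (_×_ to _·_)

  groupOrder : ℕ
  groupOrder = product ns

  instance
    groupOrder-nonZero : NonZero groupOrder
    groupOrder-nonZero = product≢0 (All.map >-nonZero pos)

  groupOrder-kills : ∀ g → groupOrder · g ≡ 0G
  groupOrder-kills = ·-common-multiple≡ε pos groupOrder (All.tabulate ∈⇒∣product)

  x-ε≡x : ∀ x → x - 0G ≡ x
  x-ε≡x x = trans (cong (x ∙_) ε⁻¹≈ε) (identityʳ x)

  x∙t-c≡t-[c-x] : ∀ x t c → x ∙ t - c ≡ t - (c - x)
  x∙t-c≡t-[c-x] x t c = begin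
    x ∙ t ∙ c ⁻¹    ≡⟨ cong (_∙ c ⁻¹) (comm x t) ⟩
    t ∙ x ∙ c ⁻¹    ≡⟨ assoc t x (c ⁻¹) ⟩
    t ∙ (x - c)     ≡⟨ cong (t ∙_) (⁻¹-anti-homo‿- c x) ⟨
    t - (c - x)     ∎
    where open ≡-Reasoning

  [t-c]∙[c-c′]≡t-c′ : ∀ t c c′ → (t - c) ∙ (c - c′) ≡ t - c′
  [t-c]∙[c-c′]≡t-c′ t c c′ = begin
    t ∙ c ⁻¹ ∙ (c ∙ c′ ⁻¹)    ≡⟨ assoc t (c ⁻¹) (c - c′) ⟩
    t ∙ (c ⁻¹ ∙ (c ∙ c′ ⁻¹))  ≡⟨ cong (t ∙_) (assoc (c ⁻¹) c (c′ ⁻¹)) ⟨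
    t ∙ (c ⁻¹ ∙ c ∙ c′ ⁻¹)    ≡⟨ cong (λ z → t ∙ (z ∙ c′ ⁻¹)) (inverseˡ c) ⟩
    t ∙ (0G ∙ c′ ⁻¹)          ≡⟨ cong (t ∙_) (identityˡ (c′ ⁻¹)) ⟩
    t - c′                    ∎
    where open ≡-Reasoning

  c-x-y≡c-y-x : ∀ c x y → c - x - y ≡ c - y - x
  c-x-y≡c-y-x c x y = begin
    c ∙ x ⁻¹ ∙ y ⁻¹    ≡⟨ assoc c (x ⁻¹) (y ⁻¹) ⟩
    c ∙ (x ⁻¹ ∙ y ⁻¹)  ≡⟨ cong (c ∙_) (comm (x ⁻¹) (y ⁻¹)) ⟩
    c ∙ (y ⁻¹ ∙ x ⁻¹)  ≡⟨ assoc c (y ⁻¹) (x ⁻¹) ⟨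
    c ∙ y ⁻¹ ∙ x ⁻¹    ∎
    where open ≡-Reasoning

  c-[x∙u]≡c-x-u : ∀ c x u → c - (x ∙ u) ≡ c - x - u
  c-[x∙u]≡c-x-u c x u = trans (cong (c ∙_) (sym (⁻¹-∙-comm x u))) (sym (assoc c (x ⁻¹) (u ⁻¹)))

  a-x-x⁻¹≡a : ∀ a x → a - x - x ⁻¹ ≡ a
  a-x-x⁻¹≡a a x = trans (assoc a (x ⁻¹) (x ⁻¹ ⁻¹)) (trans (cong (a ∙_) (inverseʳ (x ⁻¹))) (identityʳ a))

  σ-++ : ∀ U V → σ (U ++ V) ≡ σ U ∙ σ V
  σ-++ []      V = sym (identityˡ (σ V))
  σ-++ (x ∷ U) V = trans (cong (x ∙_) (σ-++ U V)) (sym (assoc x (σ U) (σ V)))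

  -- Counting subsequences with sum in a coset

  record DecSubgroup : Set₁ where
    field
      member     : G → Set
      member?    : Decidable member
      isSubgroup : IsSubgroup member
    open IsSubgroup isSubgroup public

  Ncoset : DecSubgroup → G → List G → ℕ
  Ncoset K c S = length (filter (λ T → member? (σ T - c)) (subs S))
    where open DecSubgroup K

  module _ (K : DecSubgroup) where
    open DecSubgroup K

    Ncoset-cong : ∀ {c c′} S → (∀ t → member (t - c) → member (t - c′)) → (∀ t → member (t - c′) → member (t - c)) →
                  Ncoset K c S ≡ Ncoset K c′ S
    Ncoset-cong S c⇒c′ c′⇒c = cong length (filter-≐ _ _ ((λ {T} → c⇒c′ (σ T)) , λ {T} → c′⇒c (σ T)) (subs S))

    Ncoset-∷ : ∀ c x S → Ncoset K c (x ∷ S) ≡ Ncoset K c S + Ncoset K (c - x) S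
    Ncoset-∷ c x S = trans (length-filter-subs-∷ _ x S) (cong (Ncoset K c S +_)
      (cong length (filter-≐ _ _ ((λ {T} → subst member (x∙t-c≡t-[c-x] x (σ T) c))
                                 , λ {T} → subst member (sym (x∙t-c≡t-[c-x] x (σ T) c))) (subs S))))

    Ncoset-coset : ∀ {c c′} S → member (c - c′) → Ncoset K c S ≡ Ncoset K c′ S
    Ncoset-coset {c} {c′} S c-c′∈K = Ncoset-cong S
      (λ t t-c∈K → subst member ([t-c]∙[c-c′]≡t-c′ t c c′) (+-closed _ _ t-c∈K c-c′∈K))
      (λ t t-c′∈K → subst member ([t-c]∙[c-c′]≡t-c′ t c′ c)
        (+-closed _ _ t-c′∈K (subst member (⁻¹-anti-homo‿- c c′) (neg-closed _ c-c′∈K))))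

    Ncoset-↭ : ∀ {S S′} → S ↭ S′ → ∀ c → Ncoset K c S ≡ Ncoset K c S′
    Ncoset-↭ ↭-refl          c = refl
    Ncoset-↭ (prep {xs = S} {ys = S′} x S↭S′) c = begin
      Ncoset K c (x ∷ S)                   ≡⟨ Ncoset-∷ c x S ⟩
      Ncoset K c S + Ncoset K (c - x) S    ≡⟨ cong₂ _+_ (Ncoset-↭ S↭S′ c) (Ncoset-↭ S↭S′ (c - x)) ⟩
      Ncoset K c S′ + Ncoset K (c - x) S′  ≡⟨ Ncoset-∷ c x S′ ⟨
      Ncoset K c (x ∷ S′)                  ∎
      where open ≡-Reasoning
    Ncoset-↭ (swap {xs = S} {ys = S′} x y S↭S′) c = begin
      Ncoset K c (x ∷ y ∷ S)
        ≡⟨ trans (Ncoset-∷ c x (y ∷ S)) (cong₂ _+_ (Ncoset-∷ c y S) (Ncoset-∷ (c - x) y S)) ⟩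
      (Ncoset K c S + Ncoset K (c - y) S) + (Ncoset K (c - x) S + Ncoset K (c - x - y) S)
        ≡⟨ interchange (Ncoset K c S) _ _ _ ⟩
      (Ncoset K c S + Ncoset K (c - x) S) + (Ncoset K (c - y) S + Ncoset K (c - x - y) S)
        ≡⟨ cong (λ z → (Ncoset K c S + Ncoset K (c - x) S) + (Ncoset K (c - y) S + Ncoset K z S)) (c-x-y≡c-y-x c x y) ⟩
      (Ncoset K c S + Ncoset K (c - x) S) + (Ncoset K (c - y) S + Ncoset K (c - y - x) S)
        ≡⟨ cong₂ _+_ (cong₂ _+_ (Ncoset-↭ S↭S′ c) (Ncoset-↭ S↭S′ (c - x)))
                     (cong₂ _+_ (Ncoset-↭ S↭S′ (c - y)) (Ncoset-↭ S↭S′ (c - y - x))) ⟩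
      (Ncoset K c S′ + Ncoset K (c - x) S′) + (Ncoset K (c - y) S′ + Ncoset K (c - y - x) S′)
        ≡⟨ trans (Ncoset-∷ c y (x ∷ S′)) (cong₂ _+_ (Ncoset-∷ c x S′) (Ncoset-∷ (c - y) x S′)) ⟨
      Ncoset K c (y ∷ x ∷ S′) ∎
      where open ≡-Reasoning
    Ncoset-↭ (↭-trans S↭S′ S′↭S″) c = trans (Ncoset-↭ S↭S′ c) (Ncoset-↭ S′↭S″ c)

    Ncoset-negate : ∀ U R c → Ncoset K c (U ++ R) ≡ Ncoset K (c - σ U) (map _⁻¹ U ++ R)
    Ncoset-negate []      R c = cong (λ z → Ncoset K z R) (sym (x-ε≡x c))
    Ncoset-negate (x ∷ U) R c = begin
      Ncoset K c (x ∷ U ++ R)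
        ≡⟨ Ncoset-∷ c x (U ++ R) ⟩
      Ncoset K c (U ++ R) + Ncoset K (c - x) (U ++ R)
        ≡⟨ cong₂ _+_ (Ncoset-negate U R c) (Ncoset-negate U R (c - x)) ⟩
      Ncoset K (c - σ U) W + Ncoset K (c - x - σ U) W
        ≡⟨ +-comm (Ncoset K (c - σ U) W) _ ⟩
      Ncoset K (c - x - σ U) W + Ncoset K (c - σ U) W
        ≡⟨ cong₂ (λ a b → Ncoset K a W + Ncoset K b W) (sym (c-[x∙u]≡c-x-u c x (σ U))) c-σU≡ ⟩
      Ncoset K (c - (x ∙ σ U)) W + Ncoset K (c - (x ∙ σ U) - x ⁻¹) W
        ≡⟨ Ncoset-∷ (c - (x ∙ σ U)) (x ⁻¹) W ⟨
      Ncoset K (c - (x ∙ σ U)) (x ⁻¹ ∷ W) ∎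
      where
      open ≡-Reasoning
      W : List G
      W = map _⁻¹ U ++ R
      c-σU≡ : c - σ U ≡ c - (x ∙ σ U) - x ⁻¹
      c-σU≡ = begin
        c - σ U                    ≡⟨ a-x-x⁻¹≡a (c - σ U) x ⟨
        c - σ U - x - x ⁻¹         ≡⟨ cong (_- x ⁻¹) (c-x-y≡c-y-x c (σ U) x) ⟩
        c - x - σ U - x ⁻¹         ≡⟨ cong (_- x ⁻¹) (c-[x∙u]≡c-x-u c x (σ U)) ⟨
        c - (x ∙ σ U) - x ⁻¹       ∎

    Ncoset-positive : ∀ {U S} c → U ⊆ S → member (σ U - c) → 1 ≤ Ncoset K c S
    Ncoset-positive c U⊆S σU-c∈K = filter-some (λ T → member? (σ T - c)) (lose (∈-subs⁺ U⊆S) σU-c∈K)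

    -- Olson: split off a term v of a nonempty V ⊆ S with σ V ∈ K; negating the rest of V turns the
    -- count N_(c-v) into a count of the same kind over a sequence of length |S| - 1.
    module _ {ℓ} (dav : DavProp member ℓ) where

      olson₀ : ∀ n S → length S ≡ n → 2 ^ (n + 1 ∸ ℓ) ≤ Ncoset K 0G S

      olson : ∀ n {S U} c → length S ≡ n → U ⊆ S → member (σ U - c) → 2 ^ (n + 1 ∸ ℓ) ≤ Ncoset K c S
      olson n {S} {U} c |S|≡n U⊆S σU-c∈K with ⊆⇒↭++ U⊆S
      ... | R , S↭U++R = begin
        2 ^ (n + 1 ∸ ℓ)         ≤⟨ olson₀ n S′ |S′|≡n ⟩
        Ncoset K 0G S′          ≡⟨ Ncoset-coset S′ c-σU-0∈K ⟨
        Ncoset K (c - σ U) S′   ≡⟨ Ncoset-negate U R c ⟨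
        Ncoset K c (U ++ R)     ≡⟨ Ncoset-↭ S↭U++R c ⟨
        Ncoset K c S            ∎
        where
        open ≤-Reasoning
        S′ : List G
        S′ = map _⁻¹ U ++ R
        |S′|≡n : length S′ ≡ n
        |S′|≡n = begin-equality
          length S′                  ≡⟨ length-++ (map _⁻¹ U) ⟩
          length (map _⁻¹ U) + length R ≡⟨ cong (_+ length R) (length-map _⁻¹ U) ⟩
          length U + length R        ≡⟨ length-++ U ⟨
          length (U ++ R)            ≡⟨ ↭-length S↭U++R ⟨
          length S                   ≡⟨ |S|≡n ⟩
          n                          ∎
        c-σU-0∈K : member (c - σ U - 0G)
        c-σU-0∈K = subst member (trans (⁻¹-anti-homo‿- (σ U) c) (sym (x-ε≡x _))) (neg-closed _ σU-c∈K)

      olson₀ n S |S|≡n with ℓ ≤? n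
      ... | no ℓ≰n = subst (_≤ Ncoset K 0G S) (cong (2 ^_) (sym (m≤n⇒m∸n≡0 n+1≤ℓ)))
                          (Ncoset-positive 0G (minimum S) (subst member (sym (inverseʳ 0G)) has-0))
        where
        n+1≤ℓ : n + 1 ≤ ℓ
        n+1≤ℓ = subst (_≤ ℓ) (+-comm 1 n) (≰⇒> ℓ≰n)
      ... | yes ℓ≤n with dav S (subst (ℓ ≤_) (sym |S|≡n) ℓ≤n)
      ...   | [] , _ , V≢[] , _ = ⊥-elim (V≢[] refl)
      ...   | v ∷ V₀ , V⊆S , _ , σV∈K with ⊆⇒↭++ V⊆S | n
      ...     | R , S↭ | zero   = ⊥-elim (0≢1+n (trans (sym |S|≡n) (↭-length S↭)))
      ...     | R , S↭ | suc n′ = begin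
        2 ^ (suc n′ + 1 ∸ ℓ)                          ≡⟨ cong (2 ^_) (+-∸-assoc 1 ℓ≤n′+1) ⟩
        2 ^ suc (n′ + 1 ∸ ℓ)                          ≡⟨ 2^[1+k]≡2^k+2^k (n′ + 1 ∸ ℓ) ⟩
        2 ^ (n′ + 1 ∸ ℓ) + 2 ^ (n′ + 1 ∸ ℓ)           ≤⟨ +-mono-≤ (olson n′ 0G |W|≡n′ (minimum W) 0-0∈K)
                                                                 (olson n′ (0G - v) |W|≡n′ (++⁺ʳ {as = V₀} R ⊆-refl) σV₀+v∈K) ⟩
        Ncoset K 0G W + Ncoset K (0G - v) W           ≡⟨ Ncoset-∷ 0G v W ⟨
        Ncoset K 0G (v ∷ W)                           ≡⟨ Ncoset-↭ S↭ 0G ⟨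
        Ncoset K 0G S                                 ∎
        where
        open ≤-Reasoning
        W : List G
        W = V₀ ++ R
        |W|≡n′ : length W ≡ n′
        |W|≡n′ = suc-injective (trans (sym (↭-length S↭)) |S|≡n)
        ℓ≤n′+1 : ℓ ≤ n′ + 1
        ℓ≤n′+1 = subst (ℓ ≤_) (+-comm 1 n′) ℓ≤n
        0-0∈K : member (σ [] - 0G)
        0-0∈K = subst member (sym (inverseʳ 0G)) has-0
        σV₀+v∈K : member (σ V₀ - (0G - v))
        σV₀+v∈K = subst member (trans (sym (x-ε≡x _)) (x∙t-c≡t-[c-x] v (σ V₀) 0G)) σV∈K

  trivial : DecSubgroup
  trivial = record
    { member = IsZero ; member? = _≟E 0G
    ; isSubgroup = record
      { has-0 = refl
      ; +-closed = λ { _ _ refl refl → identityˡ 0G }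
      ; neg-closed = λ { _ refl → ε⁻¹≈ε } } }

  N≡Ncoset-trivial : ∀ c S → N c S ≡ Ncoset trivial c S
  N≡Ncoset-trivial c S = cong length (filter-≐ _ _ (x≈y⇒x∙y⁻¹≈ε , λ {T} → x∙y⁻¹≈ε⇒x≈y (σ T) c) (subs S))

  N-∷ : ∀ c x S → N c (x ∷ S) ≡ N c S + N (c - x) S
  N-∷ c x S = begin
    N c (x ∷ S)                                         ≡⟨ N≡Ncoset-trivial c (x ∷ S) ⟩
    Ncoset trivial c (x ∷ S)                            ≡⟨ Ncoset-∷ trivial c x S ⟩
    Ncoset trivial c S + Ncoset trivial (c - x) S       ≡⟨ cong₂ _+_ (N≡Ncoset-trivial c S) (N≡Ncoset-trivial (c - x) S) ⟨
    N c S + N (c - x) S                                 ∎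
    where open ≡-Reasoning

  N-↭ : ∀ {S S′} → S ↭ S′ → ∀ c → N c S ≡ N c S′
  N-↭ {S} {S′} S↭S′ c =
    trans (N≡Ncoset-trivial c S) (trans (Ncoset-↭ trivial S↭S′ c) (sym (N≡Ncoset-trivial c S′)))

  N-ε-[] : N 0G [] ≡ 1
  N-ε-[] = cong length (filter-accept (λ T → σ T ≟E 0G) refl)

  N-[] : ∀ {c} → c ≢ 0G → N c [] ≡ 0
  N-[] c≢0 = cong length (filter-reject (λ T → σ T ≟E _) (c≢0 ∘ sym))

  -- Zero-sum free sequences and Davenport constants

  ZeroSumFree : (G → Set) → List G → Set
  ZeroSumFree H T = ¬ HasNZS H T

  DavProp-⊆ : ∀ {H H′ : G → Set} {ℓ} → (∀ {y} → H y → H′ y) → DavProp H ℓ → DavProp H′ ℓ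
  DavProp-⊆ H⊆H′ dav S ℓ≤|S| = let V , V⊆S , V≢[] , σV∈H = dav S ℓ≤|S| in V , V⊆S , V≢[] , H⊆H′ σV∈H

  module _ {H : G → Set} where

    zeroSumFree-⊆ : ∀ {S S′} → S ⊆ S′ → ZeroSumFree H S′ → ZeroSumFree H S
    zeroSumFree-⊆ S⊆S′ free (V , V⊆S , V≢[] , σV∈H) = free (V , ⊆-trans V⊆S S⊆S′ , V≢[] , σV∈H)

    []-zeroSumFree : ZeroSumFree H []
    []-zeroSumFree ([] , [] , []≢[] , _) = []≢[] refl

    hasNZS? : Decidable H → Decidable (HasNZS H)
    hasNZS? H? S = map′
      (λ found → let V , V∈subsS , nonzero-sum = find found in V , ∈-subs⁻ S V∈subsS , nonzero-sum)
      (λ (V , V⊆S , V≢[]×σV∈H) → lose (∈-subs⁺ V⊆S) V≢[]×σV∈H)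
      (anyᴸ? (λ V → ¬? (≡-dec _≟E_ V []) ×-dec H? (σ V)) (subs S))

    zeroSumFree⇒0∉ : ∀ {T} → H 0G → ZeroSumFree H T → 0G ∉ T
    zeroSumFree⇒0∉ 0∈H free 0∈T = free (0G ∷ [] , from∈ 0∈T , (λ ()) , subst H (sym (identityˡ 0G)) 0∈H)

    DavProp-mono : ∀ {m n} → m ≤ n → DavProp H m → DavProp H n
    DavProp-mono m≤n dav S n≤|S| = dav S (≤-trans m≤n n≤|S|)

    ¬DavProp-0 : ¬ DavProp H 0
    ¬DavProp-0 dav = []-zeroSumFree (dav [] z≤n)

    zeroSumFree⇒length< : ∀ {d T} → IsDavenportMod H d → ZeroSumFree H T → length T < d
    zeroSumFree⇒length< {T = T} (_ , dav , _) free = ≰⇒> λ d≤|T| → free (dav T d≤|T|)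

    ¬DavProp⇒¬¬zeroSumFree : Decidable H → ∀ {ℓ} → ¬ DavProp H ℓ → ¬ ¬ (∃ λ T → length T ≡ ℓ × ZeroSumFree H T)
    ¬DavProp⇒¬¬zeroSumFree H? {ℓ} ¬dav ¬∃T = ¬dav λ S ℓ≤|S| →
      decidable-stable (hasNZS? H? S) λ free →
        ¬∃T (take ℓ S , trans (length-take ℓ S) (m≤n⇒m⊓n≡m ℓ≤|S|) , zeroSumFree-⊆ (take-⊆ ℓ S) free)

    ¬¬zeroSumFree-below : Decidable H → ∀ {dH ℓ} → IsDavenportMod H dH → ℓ < dH →
                          ¬ ¬ (∃ λ T → length T ≡ ℓ × ZeroSumFree H T)
    ¬¬zeroSumFree-below H? {ℓ = zero}  _               _    k = k ([] , refl , []-zeroSumFree)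
    ¬¬zeroSumFree-below H? {ℓ = suc ℓ} (_ , _ , below) ℓ<dH =
      ¬DavProp⇒¬¬zeroSumFree H? (below (suc ℓ) (s≤s z≤n) ℓ<dH)

    -- DavProp H is not decidable, so D(G/H) exists only up to double negation; it is only ever
    -- used towards ⊥ or towards decidable goals.
    ¬¬IsDavenportMod : ∀ {n} → DavProp H n → ¬ ¬ (∃ λ ℓ → IsDavenportMod H ℓ)
    ¬¬IsDavenportMod {n} dav = ¬¬-map davenport (¬¬-least DavProp-mono n dav)
      where
      davenport : (∃ λ ℓ → DavProp H ℓ × (∀ ℓ′ → ℓ′ < ℓ → ¬ DavProp H ℓ′)) → ∃ λ ℓ → IsDavenportMod H ℓ
      davenport (zero  , dav₀ , _)     = ⊥-elim (¬DavProp-0 dav₀)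
      davenport (suc ℓ , dav , below) = suc ℓ , s≤s z≤n , dav , λ ℓ′ _ → below ℓ′

    N-zeroSumFree : ∀ {c} T → ZeroSumFree H T → H c → N c T ≡ N c []
    N-zeroSumFree     []      _    _   = refl
    N-zeroSumFree {c} (x ∷ T) free c∈H = begin
      N c (x ∷ T)          ≡⟨ N-∷ c x T ⟩
      N c T + N (c - x) T  ≡⟨ cong₂ _+_ (N-zeroSumFree T (zeroSumFree-⊆ (x ∷ʳ ⊆-refl) free) c∈H) none ⟩
      N c [] + 0           ≡⟨ +-identityʳ (N c []) ⟩
      N c []               ∎
      where
      open ≡-Reasoning
      x∙[c-x]≡c : ∀ {u} → u ≡ c - x → x ∙ u ≡ c
      x∙[c-x]≡c refl = trans (sym (assoc x c (x ⁻¹))) (xyx⁻¹≈y x c)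
      none : N (c - x) T ≡ 0
      none = cong length (filter-none (λ U → σ U ≟E (c - x)) (All.tabulate λ {U} U∈subsT σU≡c-x →
        free (x ∷ U , refl ∷ ∈-subs⁻ T U∈subsT , (λ ()) , subst H (sym (x∙[c-x]≡c σU≡c-x)) c∈H)))

  -- Disjoint minimal zero-sum subsequences: (i) ⇒ (ii)

  minimalZeroSum⇒2≤length : ∀ {S T} → 0G ∉ S → T ≼ S → IsMinZeroSum T → 2 ≤ length T
  minimalZeroSum⇒2≤length {T = []}        _   _   (T≢[] , _)     = ⊥-elim (T≢[] refl)
  minimalZeroSum⇒2≤length {T = x ∷ []}    0∉S T≼S (_ , σT≡0 , _) =
    ⊥-elim (0∉S (subst (_∈ _) (trans (sym (identityʳ x)) σT≡0) (≼-∈ T≼S (here refl))))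
  minimalZeroSum⇒2≤length {T = _ ∷ _ ∷ _} _   _   _              = s≤s (s≤s z≤n)

  i⇒ii : ∀ d → StmtI d → StmtII d
  i⇒ii d stmtI = d + d , bound
    where
    bound : ∀ S → Extremal d S → length S ≤ d + d
    bound S ext@(0∉S , d≤|S|+1 , _) with stmtI S ext
    ... | Ts , |Ts|≡m , minimal , disjoint , _ =
      ≤-trans (≤-trans (n≤1+n s) (m≤m+n (suc s) 1)) (+-cancelˡ-≤ s (suc (s + 1)) (d + d) (begin
        s + suc (s + 1)      ≡⟨ +-assoc s 1 (s + 1) ⟨
        (s + 1) + (s + 1)    ≡⟨ cong₂ _+_ m+d≡s+1 m+d≡s+1 ⟨
        (m + d) + (m + d)    ≡⟨ interchange m d m d ⟩
        (m + m) + (d + d)    ≤⟨ +-monoˡ-≤ (d + d) 2m≤s ⟩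
        s + (d + d)          ∎))
      where
      open ≤-Reasoning
      s m : ℕ
      s = length S
      m = s + 1 ∸ d
      m+d≡s+1 : m + d ≡ s + 1
      m+d≡s+1 = m∸n+n≡m d≤|S|+1
      2m≤s : m + m ≤ s
      2m≤s = begin
        m + m                    ≡⟨ cong₂ _+_ |Ts|≡m |Ts|≡m ⟨
        length Ts + length Ts    ≤⟨ 2*length≤length-concat Ts (All.map (λ (T≼S , T-min) → minimalZeroSum⇒2≤length 0∉S T≼S T-min) minimal) ⟩
        length (concat Ts)       ≤⟨ ≼⇒length≤ (≼-concat Ts (All.map proj₁ minimal) disjoint) ⟩
        s                        ∎

  -- Subgroups of order two: (ii) ⇒ (iii) and (iv) ⇒ (iii)

  module SubgroupOfOrderTwo {H : G → Set} (isSubgroup : IsSubgroup H) (iso : IsoC2 H) where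
    open IsSubgroup isSubgroup

    h : G
    h = proj₁ iso

    h≢0 : h ≢ 0G
    h≢0 = proj₁ (proj₂ iso)

    H⇒0⊎h : ∀ {x} → H x → x ≡ 0G ⊎ x ≡ h
    H⇒0⊎h {x} = proj₁ (proj₂ (proj₂ iso) x)

    H? : Decidable H
    H? x = map′ (proj₂ (proj₂ (proj₂ iso) x)) H⇒0⊎h ((x ≟E 0G) ⊎-dec (x ≟E h))

    h∈H : H h
    h∈H = proj₂ (proj₂ (proj₂ iso) h) (inj₂ refl)

    h∙h≡0 : h ∙ h ≡ 0G
    h∙h≡0 with H⇒0⊎h (+-closed h h h∈H h∈H)
    ... | inj₁ h∙h≡0 = h∙h≡0
    ... | inj₂ h∙h≡h = ⊥-elim (h≢0 (identityʳ-unique h h h∙h≡h))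

    0-h≡h : 0G - h ≡ h
    0-h≡h = trans (identityˡ (h ⁻¹)) (sym (inverseʳ-unique h h h∙h≡0))

    N-h^[1+j]++ : ∀ {T} → ZeroSumFree H T → ∀ j →
                  N 0G (replicate (suc j) h ++ T) ≡ 2 ^ j × N h (replicate (suc j) h ++ T) ≡ 2 ^ j
    N-h^[1+j]++ {T} free zero = (begin
        N 0G (h ∷ T)             ≡⟨ N-∷ 0G h T ⟩
        N 0G T + N (0G - h) T    ≡⟨ cong₂ _+_ (N-T has-0) (trans (cong (λ c → N c T) 0-h≡h) (N-T h∈H)) ⟩
        N 0G [] + N h []         ≡⟨ cong₂ _+_ N-ε-[] (N-[] h≢0) ⟩
        1                        ∎)
      , (begin
        N h (h ∷ T)              ≡⟨ N-∷ h h T ⟩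
        N h T + N (h - h) T      ≡⟨ cong₂ _+_ (N-T h∈H) (trans (cong (λ c → N c T) (inverseʳ h)) (N-T has-0)) ⟩
        N h [] + N 0G []         ≡⟨ cong₂ _+_ (N-[] h≢0) N-ε-[] ⟩
        1                        ∎)
      where
      open ≡-Reasoning
      N-T : ∀ {c} → H c → N c T ≡ N c []
      N-T = N-zeroSumFree {H = H} T free
    N-h^[1+j]++ {T} free (suc j) = (begin
        N 0G (h ∷ X)             ≡⟨ N-∷ 0G h X ⟩
        N 0G X + N (0G - h) X    ≡⟨ cong₂ _+_ N0 (trans (cong (λ c → N c X) 0-h≡h) Nh) ⟩
        2 ^ j + 2 ^ j            ≡⟨ 2^[1+k]≡2^k+2^k j ⟨
        2 ^ suc j                ∎)
      , (begin
        N h (h ∷ X)              ≡⟨ N-∷ h h X ⟩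
        N h X + N (h - h) X      ≡⟨ cong₂ _+_ Nh (trans (cong (λ c → N c X) (inverseʳ h)) N0) ⟩
        2 ^ j + 2 ^ j            ≡⟨ 2^[1+k]≡2^k+2^k j ⟨
        2 ^ suc j                ∎)
      where
      open ≡-Reasoning
      X : List G
      X = replicate (suc j) h ++ T
      N0 : N 0G X ≡ 2 ^ j
      N0 = proj₁ (N-h^[1+j]++ free j)
      Nh : N h X ≡ 2 ^ j
      Nh = proj₂ (N-h^[1+j]++ free j)

    ¬¬short-zeroSumFree : ∀ {d dH} → IsDavenport d → IsDavenportMod H dH → ¬ (dH + 2 ≤ d) →
                          ¬ ¬ (∃ λ T → length T + 2 ≡ d × ZeroSumFree H T)
    ¬¬short-zeroSumFree {d} {dH} dav davH dH+2≰d =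
      ¬¬-map (λ (T , |T|≡d′ , free) → T , trans (cong (_+ 2) |T|≡d′) d′+2≡d , free)
             (¬¬zeroSumFree-below H? davH d′<dH)
      where
      [h]-free : ZeroSumFree IsZero (h ∷ [])
      [h]-free (_ , _ ∷ʳ []    , []≢[] , _)  = []≢[] refl
      [h]-free (_ , refl ∷ [] , _     , σ≡0) = h≢0 (trans (sym (identityʳ h)) σ≡0)
      d′ : ℕ
      d′ = d ∸ 2
      d′+2≡d : d′ + 2 ≡ d
      d′+2≡d = m∸n+n≡m (zeroSumFree⇒length< {H = IsZero} dav [h]-free)
      d′<dH : d′ < dH
      d′<dH = +-cancelʳ-≤ 2 (suc d′) dH (subst (λ n → suc n ≤ dH + 2) (sym d′+2≡d) (≰⇒> dH+2≰d))

  iv⇒iii : ∀ d → IsDavenport d → StmtIV d → StmtIII d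
  iv⇒iii d dav stmtIV H isSubgroup iso dH davH =
    decidable-stable (dH + 2 ≤? d) λ dH+2≰d → ¬¬short-zeroSumFree dav davH dH+2≰d λ (T , |T|+2≡d , free) →
      h≢0 (stmtIV (h ∷ T) (≤-reflexive (d≡|h∷T|+1 T |T|+2≡d)) H isSubgroup (H⊆E[h∷T] T |T|+2≡d free) h h∈H)
    where
    open SubgroupOfOrderTwo isSubgroup iso
    d≡|h∷T|+1 : ∀ T → length T + 2 ≡ d → d ≡ length (h ∷ T) + 1
    d≡|h∷T|+1 T |T|+2≡d = trans (sym |T|+2≡d) (+-suc (length T) 1)
    H⊆E[h∷T] : ∀ T → length T + 2 ≡ d → ZeroSumFree H T → ∀ x → H x → InE d (h ∷ T) x
    H⊆E[h∷T] T |T|+2≡d free x x∈H =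
      trans (N≡1 (H⇒0⊎h x∈H)) (cong (2 ^_) (sym (m≤n⇒m∸n≡0 {length (h ∷ T) + 1} (≤-reflexive (sym (d≡|h∷T|+1 T |T|+2≡d))))))
      where
      N≡1 : x ≡ 0G ⊎ x ≡ h → N x (h ∷ T) ≡ 1
      N≡1 (inj₁ refl) = proj₁ (N-h^[1+j]++ free 0)
      N≡1 (inj₂ refl) = proj₂ (N-h^[1+j]++ free 0)

  ii⇒iii : ∀ d → IsDavenport d → StmtII d → StmtIII d
  ii⇒iii d dav (t , bound) H isSubgroup iso dH davH =
    decidable-stable (dH + 2 ≤? d) λ dH+2≰d → ¬¬short-zeroSumFree dav davH dH+2≰d λ (T , |T|+2≡d , free) →
      1+n≰n (≤-trans (t<|S| T) (bound (S T) (extremal T |T|+2≡d free)))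
    where
    open SubgroupOfOrderTwo isSubgroup iso
    open IsSubgroup isSubgroup
    S : List G → List G
    S T = replicate (suc t) h ++ T
    t<|S| : ∀ T → t < length (S T)
    t<|S| T = subst (_≤ length (S T)) (length-replicate (suc t)) (length-++-≤ˡ (replicate (suc t) h))
    |S|+1≡t+d : ∀ T → length T + 2 ≡ d → length (S T) + 1 ≡ t + d
    |S|+1≡t+d T |T|+2≡d = begin
      length (S T) + 1                             ≡⟨ cong (_+ 1) (length-++ (replicate (suc t) h)) ⟩
      length (replicate (suc t) h) + length T + 1  ≡⟨ cong (λ n → n + length T + 1) (length-replicate (suc t)) ⟩
      suc t + length T + 1                         ≡⟨ [1+t]+a+1≡t+[a+2] t (length T) ⟩
      t + (length T + 2)                           ≡⟨ cong (t +_) |T|+2≡d ⟩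
      t + d                                        ∎
      where open ≡-Reasoning
    extremal : ∀ T → length T + 2 ≡ d → ZeroSumFree H T → Extremal d (S T)
    extremal T |T|+2≡d free =
        All¬⇒¬Any (++⁺ (replicate⁺ (suc t) (h≢0 ∘ sym))
                       (All.tabulate λ x∈T 0≡x → zeroSumFree⇒0∉ {H = H} has-0 free (subst (_∈ T) (sym 0≡x) x∈T)))
      , subst (d ≤_) (sym (|S|+1≡t+d T |T|+2≡d)) (m≤n+m d t)
      , trans (proj₁ (N-h^[1+j]++ free t)) (cong (2 ^_) (sym (trans (cong (_∸ d) (|S|+1≡t+d T |T|+2≡d)) (m+n∸n≡m t d))))

  -- Cyclic subgroups: (iii) ⇒ (iv)

  σ-replicate : ∀ n g → σ (replicate n g) ≡ n · g
  σ-replicate zero    g = refl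
  σ-replicate (suc n) g = cong (g ∙_) (σ-replicate n g)

  n·ε≡ε : ∀ n → n · 0G ≡ 0G
  n·ε≡ε zero    = refl
  n·ε≡ε (suc n) = trans (identityˡ (n · 0G)) (n·ε≡ε n)

  ·-% : ∀ k .{{_ : NonZero k}} {g} → k · g ≡ 0G → ∀ b → b · g ≡ (b % k) · g
  ·-% k {g} k·g≡0 b = begin
    b · g                                ≡⟨ cong (_· g) (m≡m%n+[m/n]*n b k) ⟩
    (b % k + b / k * k) · g              ≡⟨ ×-homo-+ g (b % k) (b / k * k) ⟩
    (b % k) · g ∙ (b / k * k) · g        ≡⟨ cong ((b % k) · g ∙_) (×-assocˡ g (b / k) k) ⟨
    (b % k) · g ∙ (b / k) · (k · g)      ≡⟨ cong (λ y → (b % k) · g ∙ (b / k) · y) k·g≡0 ⟩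
    (b % k) · g ∙ (b / k) · 0G           ≡⟨ cong ((b % k) · g ∙_) (n·ε≡ε (b / k)) ⟩
    (b % k) · g ∙ 0G                     ≡⟨ identityʳ _ ⟩
    (b % k) · g                          ∎
    where open ≡-Reasoning

  ⁻¹≡[groupOrder∸1]· : ∀ g → g ⁻¹ ≡ (groupOrder ∸ 1) · g
  ⁻¹≡[groupOrder∸1]· g =
    sym (inverseʳ-unique g ((groupOrder ∸ 1) · g) (trans (cong (_· g) (suc-pred groupOrder)) (groupOrder-kills g)))

  ⟨_⟩ : G → G → Set
  ⟨ g ⟩ y = ∃ λ b → y ≡ b · g

  g∈⟨g⟩ : ∀ g → ⟨ g ⟩ g
  g∈⟨g⟩ g = 1 , sym (identityʳ g)

  ⟨⟩-isSubgroup : ∀ g → IsSubgroup ⟨ g ⟩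
  ⟨⟩-isSubgroup g = record
    { has-0      = 0 , refl
    ; +-closed   = λ { _ _ (a , refl) (b , refl) → a + b , sym (×-homo-+ g a b) }
    ; neg-closed = λ { _ (b , refl) → (groupOrder ∸ 1) * b , trans (⁻¹≡[groupOrder∸1]· (b · g)) (×-assocˡ g (groupOrder ∸ 1) b) } }

  ⟨⟩⊆ : ∀ {H g} → IsSubgroup H → H g → ∀ {y} → ⟨ g ⟩ y → H y
  ⟨⟩⊆ {H} {g} isSubgroup g∈H (b , refl) = multiples b
    where
    open IsSubgroup isSubgroup
    multiples : ∀ b → H (b · g)
    multiples zero    = has-0
    multiples (suc b) = +-closed g (b · g) g∈H (multiples b)

  order : ∀ g → ∃ λ k → 1 ≤ k × k · g ≡ 0G × (∀ j → 1 ≤ j → j < k → j · g ≢ 0G)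
  order g = least-vanishing (¬∀⟶∃¬-smallest groupOrder (λ i → suc (toℕ i) · g ≢ 0G) (λ i → ¬? ((suc (toℕ i) · g) ≟E 0G)) vanishes)
    where
    vanishes : ¬ (∀ i → suc (toℕ i) · g ≢ 0G)
    vanishes all = all (Fin.fromℕ< |G|∸1<|G|)
      (trans (cong (λ n → suc n · g) (toℕ-fromℕ< |G|∸1<|G|)) (trans (cong (_· g) (suc-pred groupOrder)) (groupOrder-kills g)))
      where
      |G|∸1<|G| : groupOrder ∸ 1 < groupOrder
      |G|∸1<|G| = ≤-reflexive (suc-pred groupOrder)
    least-vanishing : (∃ λ i → ¬ suc (toℕ i) · g ≢ 0G × ((j : Fin.Fin′ i) → suc (toℕ (Fin.inject j)) · g ≢ 0G)) →
                      ∃ λ k → 1 ≤ k × k · g ≡ 0G × (∀ j → 1 ≤ j → j < k → j · g ≢ 0G)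
    least-vanishing (i , ¬[1+i]·g≢0 , below) = suc (toℕ i) , s≤s z≤n , decidable-stable (_ ≟E 0G) ¬[1+i]·g≢0 , nonzero-below
      where
      nonzero-below : ∀ j → 1 ≤ j → j < suc (toℕ i) → j · g ≢ 0G
      nonzero-below (suc j) _ (s≤s j<i) =
        subst (λ n → suc n · g ≢ 0G) (trans (toℕ-inject (Fin.fromℕ< j<i)) (toℕ-fromℕ< j<i)) (below (Fin.fromℕ< j<i))

  module CyclicSubgroup (x : G) (k : ℕ) .{{_ : NonZero k}} (k·x≡0 : k · x ≡ 0G) where

    ⟨x⟩⇒bounded : ∀ {y} → ⟨ x ⟩ y → ∃ λ (j : Fin k) → y ≡ toℕ j · x
    ⟨x⟩⇒bounded (b , refl) = Fin.fromℕ< (m%n<n b k) , trans (·-% k k·x≡0 b) (cong (_· x) (sym (toℕ-fromℕ< (m%n<n b k))))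

    ⟨x⟩-decSubgroup : DecSubgroup
    ⟨x⟩-decSubgroup = record
      { member     = ⟨ x ⟩
      ; member?    = λ y → map′ (λ (j , y≡j·x) → toℕ j , y≡j·x) ⟨x⟩⇒bounded (any? λ j → y ≟E (toℕ j · x))
      ; isSubgroup = ⟨⟩-isSubgroup x }

    Ncoset-⟨x⟩-≤ : ∀ {b} S → (∀ {y} → ⟨ x ⟩ y → N y S ≤ b) → Ncoset ⟨x⟩-decSubgroup 0G S ≤ k * b
    Ncoset-⟨x⟩-≤ {b} S N≤b = subst (λ n → Ncoset ⟨x⟩-decSubgroup 0G S ≤ n * b) (length-tabulate (λ (j : Fin k) → toℕ j · x))
      (length-filter-≤-classes _≟E_ σ _ multiples (subs S) (λ {T} → classified {T}) bounded)
      where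
      multiples : List G
      multiples = tabulate (λ (j : Fin k) → toℕ j · x)
      classified : ∀ {T} → ⟨ x ⟩ (σ T - 0G) → σ T ∈ multiples
      classified {T} σT-0∈⟨x⟩ with ⟨x⟩⇒bounded (subst ⟨ x ⟩ (x-ε≡x (σ T)) σT-0∈⟨x⟩)
      ... | j , σT≡j·x = subst (_∈ multiples) (sym σT≡j·x) (∈-tabulate⁺ j)
      bounded : ∀ {c} → c ∈ multiples → N c S ≤ b
      bounded c∈ with ∈-tabulate⁻ c∈
      ... | j , c≡j·x = N≤b (toℕ j , c≡j·x)

    replicate-++-zeroSumFree : (∀ j → 1 ≤ j → j < k → j · x ≢ 0G) →
                               ∀ {T} → ZeroSumFree ⟨ x ⟩ T → ZeroSumFree IsZero (replicate (k ∸ 1) x ++ T)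
    replicate-++-zeroSumFree minimal {T} free (V , V⊆ , V≢[] , σV≡0) with ⊆-++⁻ (replicate (k ∸ 1) x) V⊆
    ... | V₁ , V₂ , refl , V₁⊆ , V₂⊆T = split V₂ V₂⊆T V≢[] σV≡0
      where
      a : ℕ
      a = length V₁
      σV₁≡a·x : σ V₁ ≡ a · x
      σV₁≡a·x = trans (cong σ (⊆-replicate⁻ (k ∸ 1) V₁⊆)) (σ-replicate a x)
      a<k : a < k
      a<k = ≤-trans (s≤s (≤-trans (length-mono-≤ V₁⊆) (≤-reflexive (length-replicate (k ∸ 1))))) (≤-reflexive (suc-pred k))
      split : ∀ V₂ → V₂ ⊆ T → V₁ ++ V₂ ≢ [] → σ (V₁ ++ V₂) ≡ 0G → ⊥
      split [] _ V≢[] σV≡0 = minimal a (1≤a V₁ V≢[]) a<k (trans (sym σV₁≡a·x) (trans (sym (identityʳ (σ V₁))) (trans (sym (σ-++ V₁ [])) σV≡0)))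
        where
        1≤a : ∀ U → U ++ [] ≢ [] → 1 ≤ length U
        1≤a []      U≢[] = ⊥-elim (U≢[] refl)
        1≤a (_ ∷ _) _    = s≤s z≤n
      split (v ∷ V₂) V₂⊆T _ σV≡0 = free (v ∷ V₂ , V₂⊆T , (λ ()) , subst ⟨ x ⟩ (sym σV₂≡[a·x]⁻¹) (neg-closed _ (a , refl)))
        where
        open IsSubgroup (⟨⟩-isSubgroup x)
        σV₂≡[a·x]⁻¹ : σ (v ∷ V₂) ≡ (a · x) ⁻¹
        σV₂≡[a·x]⁻¹ = trans (inverseʳ-unique (σ V₁) (σ (v ∷ V₂)) (trans (sym (σ-++ V₁ (v ∷ V₂))) σV≡0)) (cong _⁻¹ σV₁≡a·x)

    davenport-gap : ∀ {d ℓ} → IsDavenport d → IsDavenportMod ⟨ x ⟩ ℓ → (∀ j → 1 ≤ j → j < k → j · x ≢ 0G) →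
                    ℓ + (k ∸ 1) ≤ d
    davenport-gap {d} {ℓ} dav dav⟨x⟩@(1≤ℓ , _) minimal =
      decidable-stable (ℓ + (k ∸ 1) ≤? d) λ ℓ+k-1≰d →
        ¬¬zeroSumFree-below (DecSubgroup.member? ⟨x⟩-decSubgroup) dav⟨x⟩ (≤-reflexive (suc-pred ℓ {{>-nonZero 1≤ℓ}}))
          λ (T , |T|≡ℓ-1 , free) → ℓ+k-1≰d (begin
            ℓ + (k ∸ 1)                                    ≡⟨ cong (_+ (k ∸ 1)) (suc-pred ℓ {{>-nonZero 1≤ℓ}}) ⟨
            suc (ℓ ∸ 1) + (k ∸ 1)                          ≡⟨ cong suc (+-comm (ℓ ∸ 1) (k ∸ 1)) ⟩
            suc ((k ∸ 1) + (ℓ ∸ 1))                        ≡⟨ cong suc (cong₂ _+_ (length-replicate (k ∸ 1)) |T|≡ℓ-1) ⟨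
            suc (length (replicate (k ∸ 1) x) + length T)  ≡⟨ cong suc (length-++ (replicate (k ∸ 1) x)) ⟨
            suc (length (replicate (k ∸ 1) x ++ T))        ≤⟨ zeroSumFree⇒length< {H = IsZero} dav (replicate-++-zeroSumFree minimal free) ⟩
            d                                              ∎)
      where open ≤-Reasoning

    ⟨x⟩-isoC2 : k ≡ 2 → x ≢ 0G → IsoC2 ⟨ x ⟩
    ⟨x⟩-isoC2 k≡2 x≢0 = x , x≢0 , λ y → to , from
      where
      to : ∀ {y} → ⟨ x ⟩ y → y ≡ 0G ⊎ y ≡ x
      to {y} y∈⟨x⟩ with ⟨x⟩⇒bounded y∈⟨x⟩
      ... | j , y≡j·x = below-2 (toℕ j) (subst (toℕ j <_) k≡2 (toℕ<n j)) y≡j·x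
        where
        below-2 : ∀ i → i < 2 → y ≡ i · x → y ≡ 0G ⊎ y ≡ x
        below-2 0 _ y≡0 = inj₁ y≡0
        below-2 1 _ y≡x∙0 = inj₂ (trans y≡x∙0 (identityʳ x))
        below-2 (suc (suc _)) (s≤s (s≤s ())) _
      from : ∀ {y} → y ≡ 0G ⊎ y ≡ x → ⟨ x ⟩ y
      from (inj₁ refl) = 0 , refl
      from (inj₂ refl) = g∈⟨g⟩ x

  iii⇒iv : ∀ d → IsDavenport d → StmtIII d → StmtIV d
  iii⇒iv d dav stmtIII S d≤|S|+1 H isSubgroup H⊆E x x∈H = decidable-stable (x ≟E 0G) λ x≢0 →
    let k , 1≤k , k·x≡0 , minimal = order x
    in cyclic-contradiction x≢0 k {{>-nonZero 1≤k}} k·x≡0 minimal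
    where
    cyclic-contradiction : x ≢ 0G → ∀ k .{{_ : NonZero k}} → k · x ≡ 0G → (∀ j → 1 ≤ j → j < k → j · x ≢ 0G) → ⊥
    cyclic-contradiction x≢0 (suc zero) x∙0≡0 _ = x≢0 (trans (sym (identityʳ x)) x∙0≡0)
    cyclic-contradiction x≢0 k@(suc k′@(suc _)) k·x≡0 minimal =
      ¬¬IsDavenportMod {H = ⟨ x ⟩} (DavProp-⊆ {H = IsZero} {H′ = ⟨ x ⟩} (λ y≡0 → 0 , y≡0) (proj₁ (proj₂ dav))) λ (ℓ , dav⟨x⟩) →
        let J , k<2^J , ℓ+J≤d = choose-J k′ (s≤s z≤n) (davenport-gap dav dav⟨x⟩ minimal)
                                  (λ k′≡1 → stmtIII ⟨ x ⟩ (⟨⟩-isSubgroup x) (⟨x⟩-isoC2 (cong suc k′≡1) x≢0) ℓ dav⟨x⟩)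
        in 2^-squeeze {ℓ = ℓ} {J} ℓ+J≤d d≤|S|+1 k<2^J (begin
          2 ^ (length S + 1 ∸ ℓ)      ≤⟨ olson K (proj₁ (proj₂ dav⟨x⟩)) (length S) 0G refl (minimum S) (0 , inverseʳ 0G) ⟩
          Ncoset K 0G S               ≤⟨ Ncoset-⟨x⟩-≤ S (λ y∈⟨x⟩ → ≤-reflexive (H⊆E _ (⟨⟩⊆ isSubgroup x∈H y∈⟨x⟩))) ⟩
          k * 2 ^ (length S + 1 ∸ d)  ∎)
      where
      open CyclicSubgroup x k k·x≡0
      open ≤-Reasoning
      K : DecSubgroup
      K = ⟨x⟩-decSubgroup

  -- Peeling off a repeated term: (iv) ⇒ (ii)

  module Peeling (d : ℕ) (dav : IsDavenport d) (g : G) (S′ : List G) (d≤|S′|+1 : d ≤ length S′ + 1) where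

    T : ℕ → List G
    T n = replicate n g ++ S′

    excess : ℕ → ℕ
    excess n = length (T n) + 1 ∸ d

    length-T : ∀ n → length (T n) ≡ n + length S′
    length-T n = trans (length-++ (replicate n g)) (cong (_+ length S′) (length-replicate n))

    d≤|T|+1 : ∀ n → d ≤ length (T n) + 1
    d≤|T|+1 n = ≤-trans d≤|S′|+1 (+-monoˡ-≤ 1 (≤-trans (m≤n+m (length S′) n) (≤-reflexive (sym (length-T n)))))

    excess-suc : ∀ n → excess (suc n) ≡ suc (excess n)
    excess-suc n = +-∸-assoc 1 (d≤|T|+1 n)

    reachable : ∀ {n c} → groupOrder ≤ n → ⟨ g ⟩ c → 2 ^ excess n ≤ N c (T n)
    reachable {n} {c} |G|≤n (b , refl) = subst (2 ^ excess n ≤_) (sym (N≡Ncoset-trivial (b · g) (T n)))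
      (olson trivial (proj₁ (proj₂ dav)) (length (T n)) (b · g) refl
        (++⁺ʳ S′ (replicate-⊆ (≤-trans (<⇒≤ (m%n<n b groupOrder)) |G|≤n)))
        (x≈y⇒x∙y⁻¹≈ε (trans (σ-replicate (b % groupOrder) g) (sym (·-% groupOrder (groupOrder-kills g) b)))))

    -- The two Olson bounds add up to N_c(g T) exactly, so both are equalities.
    split : ∀ {n c} → groupOrder ≤ n → ⟨ g ⟩ c → InE d (g ∷ T n) c → InE d (T n) c × InE d (T n) (c - g)
    split {n} {c} |G|≤n c∈⟨g⟩ c∈E = +-halves (begin
        N c (T n) + N (c - g) (T n)  ≡⟨ N-∷ c g (T n) ⟨
        N c (g ∷ T n)                ≡⟨ c∈E ⟩
        2 ^ excess (suc n)           ≡⟨ cong (2 ^_) (excess-suc n) ⟩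
        2 ^ suc (excess n)           ≡⟨ 2^[1+k]≡2^k+2^k (excess n) ⟩
        2 ^ excess n + 2 ^ excess n  ∎)
      (reachable |G|≤n c∈⟨g⟩) (reachable |G|≤n (+-closed c (g ⁻¹) c∈⟨g⟩ (neg-closed g (g∈⟨g⟩ g))))
      where
      open ≡-Reasoning
      open IsSubgroup (⟨⟩-isSubgroup g)

    multiple-of-g⁻¹ : ∀ b → ⟨ g ⟩ (b · (g ⁻¹))
    multiple-of-g⁻¹ b = ⟨⟩⊆ (⟨⟩-isSubgroup g) (IsSubgroup.neg-closed (⟨⟩-isSubgroup g) g (g∈⟨g⟩ g)) (b , refl)

    peel : ∀ i n → groupOrder ≤ n → InE d (T (i + n)) 0G → ∀ b → b ≤ i → InE d (T n) (b · (g ⁻¹))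
    peel zero    n _   0∈E .0 z≤n = 0∈E
    peel (suc i) n |G|≤n 0∈E b b≤1+i = step (m≤n⇒m<n∨m≡n b≤1+i)
      where
      IH : ∀ b → b ≤ i → InE d (g ∷ T n) (b · (g ⁻¹))
      IH = peel i (suc n) (m≤n⇒m≤1+n |G|≤n) (subst (λ j → InE d (T j) 0G) (sym (+-suc i n)) 0∈E)
      step : b < suc i ⊎ b ≡ suc i → InE d (T n) (b · (g ⁻¹))
      step (inj₁ (s≤s b≤i)) = proj₁ (split |G|≤n (multiple-of-g⁻¹ b) (IH b b≤i))
      step (inj₂ refl)      =
        subst (InE d (T n)) (comm (i · (g ⁻¹)) (g ⁻¹)) (proj₂ (split |G|≤n (multiple-of-g⁻¹ i) (IH i ≤-refl)))

  iv⇒ii : ∀ d → IsDavenport d → StmtIV d → StmtII d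
  iv⇒ii d dav stmtIV = t , bound
    where
    -- Peeling walks through |G| copies of g while keeping |G| of them, enough to reach all of ⟨g⟩.
    R t : ℕ
    R = groupOrder + groupOrder
    t = length (allElements ns) * R + R + d
    bound : ∀ S → Extremal d S → length S ≤ t
    bound S (0∉S , _ , N0≡) with length S ≤? t
    ... | yes |S|≤t = |S|≤t
    ... | no |S|≰t with pigeonhole _≟E_ (allElements ns) R S (All.tabulate λ {x} _ → ∈-allElements x)
    ...   | inj₂ |S|≤LR = ⊥-elim (|S|≰t (≤-trans |S|≤LR (≤-trans (m≤m+n _ R) (m≤m+n _ d))))
    ...   | inj₁ (g , S′ , S↭) = ⊥-elim (0∉S (subst (_∈ S) g≡0 g∈S))
      where
      g∈S : g ∈ S
      g∈S = ∈-resp-↭ (↭-sym S↭) (∈-++⁺ˡ (∈-replicate⁺ (≤-trans (>-nonZero⁻¹ groupOrder) (m≤m+n groupOrder groupOrder))))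
      d≤|S′|+1 : d ≤ length S′ + 1
      d≤|S′|+1 = m≤n⇒m≤n+o 1 (+-cancelˡ-≤ R d (length S′) (begin
        R + d                                   ≤⟨ +-monoˡ-≤ d (m≤n+m R (length (allElements ns) * R)) ⟩
        t                                       ≤⟨ <⇒≤ (≰⇒> |S|≰t) ⟩
        length S                                ≡⟨ ↭-length S↭ ⟩
        length (replicate R g ++ S′)            ≡⟨ length-++ (replicate R g) ⟩
        length (replicate R g) + length S′      ≡⟨ cong (_+ length S′) (length-replicate R) ⟩
        R + length S′                           ∎))
        where open ≤-Reasoning
      open Peeling d dav g S′ d≤|S′|+1
      0∈E[T-R] : InE d (T R) 0G
      0∈E[T-R] = trans (sym (N-↭ S↭ 0G)) (trans N0≡ (cong (λ n → 2 ^ (n + 1 ∸ d)) (↭-length S↭)))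
      ⟨g⁻¹⟩⊆E : ∀ y → ⟨ g ⁻¹ ⟩ y → InE d (T groupOrder) y
      ⟨g⁻¹⟩⊆E _ (b , refl) = subst (InE d (T groupOrder)) (sym (·-% groupOrder (groupOrder-kills (g ⁻¹)) b))
        (peel groupOrder groupOrder ≤-refl 0∈E[T-R] (b % groupOrder) (m%n≤n b groupOrder))
      g⁻¹≡0 : g ⁻¹ ≡ 0G
      g⁻¹≡0 = stmtIV (T groupOrder) (d≤|T|+1 groupOrder) ⟨ g ⁻¹ ⟩ (⟨⟩-isSubgroup (g ⁻¹)) ⟨g⁻¹⟩⊆E (g ⁻¹) (g∈⟨g⟩ (g ⁻¹))
      g≡0 : g ≡ 0G
      g≡0 = trans (sym (⁻¹-involutive g)) (trans (cong _⁻¹ g⁻¹≡0) ε⁻¹≈ε)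

theorem3p7 : (ns : List ℕ) (pos : All (0 <_) ns) → Linked _∣_ ns →
    (d : ℕ) → Group.IsDavenport ns pos d →
      (Group.StmtI ns pos d → Group.StmtII ns pos d)
      × (Group.StmtII ns pos d → Group.StmtIII ns pos d)
      × (Group.StmtIII ns pos d → Group.StmtII ns pos d)
      × (Group.StmtIII ns pos d → Group.StmtIV ns pos d)
      × (Group.StmtIV ns pos d → Group.StmtIII ns pos d)
theorem3p7 ns pos _ d dav =
    i⇒ii ns pos d
  , ii⇒iii ns pos d dav
  , iv⇒ii ns pos d dav ∘ iii⇒iv ns pos d dav
  , iii⇒iv ns pos d dav
  , iv⇒iii ns pos d dav
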